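{- Let $p$ be a prime, $n=p^2$, and let $\Gamma=\Gamma(D_{2n})$ be the intersection graph of $D_{2n}$. Then the Wiener index of $\Gamma$ is $W(\Gamma)=\frac{1}{2}(3p^4+3p^3+5p^2+3p+2)$.
   Context: $D_{2n}=\langle r,s : r^n=s^2=1,\ srs=r^{ -1}\rangle$ is the dihedral group of order $2n$. The intersection graph $\Gamma(G)$ of a finite group $G$ has as vertices the proper non-trivial subgroups of $G$, two distinct vertices being adjacent iff their intersection is non-trivial. The Wiener index is $W(\Gamma)=\sum_{\{u,v\}\subseteq V(\Gamma)} d(u,v)$, summed over unordered pairs of distinct vertices, where $d$ is graph distance. -}

module Defs where

open import Data.Nat using (ℕ; zero; suc; _+_; _∸_; _<_; _<ᵇ_; _≡ᵇ_)
open import Data.Nat.DivMod using (_mod_)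
open import Data.Fin using (Fin; toℕ)
open import Data.Bool using (Bool; true; false; not; _∧_; _∨_; _xor_; T; if_then_else_)
open import Data.Product using (Σ; _×_; _,_)
open import Data.Vec using (Vec; []; _∷_; lookup)
open import Data.List using (List; []; _∷_; map; _++_; concatMap; allFin; filterᵇ; length)
open import Data.Bool.ListAction using (all; any)
open import Data.Nat.ListAction using (sum)
import Data.List as List
open import Relation.Binary.PropositionalEquality using (_≡_; _≢_)
open import Relation.Nullary using (¬_)

-- The element (i , b) stands for r^i s^b  (i ∈ ℤ/n, b ∈ {0,1}, true = 1).
-- Multiplication: r^i s^a · r^j s^b = r^(i + (-1)^a j) s^(a+b).

addMod : {n : ℕ} → Fin n → Fin n → Fin n
addMod {suc m} i j = (toℕ i + toℕ j) mod (suc m)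

negMod : {n : ℕ} → Fin n → Fin n
negMod {suc m} j = (suc m ∸ toℕ j) mod (suc m)

D : ℕ → Set
D n = Fin n × Bool

_·_ : {n : ℕ} → D n → D n → D n
(i , a) · (j , b) = addMod i (if a then negMod j else j) , (a xor b)

inv : {n : ℕ} → D n → D n
inv (i , false) = negMod i , false
inv (i , true)  = i , true

isId : {n : ℕ} → D n → Bool
isId (i , b) = not b ∧ (toℕ i ≡ᵇ 0)

elems : (n : ℕ) → List (D n)
elems n = map (λ i → i , false) (allFin n) ++ map (λ i → i , true) (allFin n)

-- Subsets of D_{2n}: a characteristic vector for the rotations r^i and
-- one for the reflections r^i s.

Sub : ℕ → Set
Sub n = Vec Bool n × Vec Bool n

mem : {n : ℕ} → D n → Sub n → Bool
mem (i , false) (R , S) = lookup R i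
mem (i , true)  (R , S) = lookup S i

vecs : (k : ℕ) → List (Vec Bool k)
vecs zero    = [] ∷ []
vecs (suc k) = concatMap (λ v → (false ∷ v) ∷ (true ∷ v) ∷ []) (vecs k)

subsets : (n : ℕ) → List (Sub n)
subsets n = concatMap (λ R → map (λ S → R , S) (vecs n)) (vecs n)

isSubgroup : {n : ℕ} → Sub n → Bool
isSubgroup {n} H =
  any (λ x → isId x ∧ mem x H) (elems n)
  ∧ all (λ x → all (λ y → not (mem x H ∧ mem y H) ∨ mem (x · y) H) (elems n)) (elems n)
  ∧ all (λ x → not (mem x H) ∨ mem (inv x) H) (elems n)

isNontrivial : {n : ℕ} → Sub n → Bool
isNontrivial {n} H = any (λ x → not (isId x) ∧ mem x H) (elems n)

isProper : {n : ℕ} → Sub n → Bool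
isProper {n} H = any (λ x → not (mem x H)) (elems n)

meetNontrivially : {n : ℕ} → Sub n → Sub n → Bool
meetNontrivially {n} H K = any (λ x → not (isId x) ∧ mem x H ∧ mem x K) (elems n)

record Graph : Set₁ where
  field
    size : ℕ
    Adj  : Fin size → Fin size → Set

open Graph public

data Walk (G : Graph) : Fin (size G) → Fin (size G) → ℕ → Set where
  here : ∀ {u} → Walk G u u 0
  step : ∀ {u v w k} → Adj G u v → Walk G v w k → Walk G u w (suc k)

IsDistance : (G : Graph) → Fin (size G) → Fin (size G) → ℕ → Set
IsDistance G u v k = Walk G u v k × (∀ l → l < k → ¬ Walk G u v l)

sumPairs : (m : ℕ) → (Fin m → Fin m → ℕ) → ℕ
sumPairs m d =
  sum (concatMap (λ i → map (λ j → d i j) (filterᵇ (λ j → toℕ i <ᵇ toℕ j) (allFin m))) (allFin m))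

HasWienerIndex : Graph → ℕ → Set
HasWienerIndex G w =
  Σ (Fin (size G) → Fin (size G) → ℕ) λ d →
    (∀ u v → IsDistance G u v (d u v)) × (w ≡ sumPairs (size G) d)

vertices : (n : ℕ) → List (Sub n)
vertices n = filterᵇ (λ H → isSubgroup H ∧ isNontrivial H ∧ isProper H) (subsets n)

IntersectionGraphD : ℕ → Graph
IntersectionGraphD n = record
  { size = length (vertices n)
  ; Adj  = λ i j → i ≢ j × T (meetNontrivially (List.lookup (vertices n) i) (List.lookup (vertices n) j))
  }

module Submission where

open import Defs
open import Level using (Level)
open import Function using (_∘_; id; Equivalence)
open import Data.Bool using (Bool; true; false; not; _∧_; _∨_; T; T?; if_then_else_)
import Data.Bool.Properties as Bool
open import Data.Bool.ListAction using (all; any)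
open import Data.Empty using (⊥-elim)
open import Data.Fin using (Fin; toℕ) renaming (zero to fzero; suc to fsuc)
import Data.Fin.Properties as Fin
open import Data.List using (List; []; _∷_; map; _++_; concatMap; filterᵇ; length; downFrom; allFin)
import Data.List as List
open import Data.List.Properties using (length-downFrom; length-tabulate)
open import Data.List.Membership.Propositional using (_∈_)
open import Data.List.Membership.Propositional.Properties
  using (∈-++⁺ˡ; ∈-++⁺ʳ; ∈-++⁻; ∈-map⁺; ∈-map⁻; ∈-allFin; ∈-downFrom⁻; ∈-filter⁺; ∈-filter⁻; ∈-lookup)
open import Data.List.Relation.Unary.Any using (here; there)
import Data.List.Relation.Unary.Any as Any
open import Data.List.Relation.Unary.Any.Properties using (lookup-index)
open import Data.Nat using (ℕ; zero; suc; _+_; _*_; _^_; _∸_; _<_; _≤_; z≤n; s≤s; _<ᵇ_; _≡ᵇ_; _%_; NonZero)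
open import Data.Nat.Properties
open import Data.Nat.DivMod
open import Data.Nat.Divisibility using (_∣_; _∣?_; divides; ∣-refl; ∣-trans; m%n≡0⇒n∣m; n∣m⇒m%n≡0)
open import Data.Nat.GCD using (gcd; gcd-GCD; c*gcd[m,n]≡gcd[cm,cn]; module Bézout)
open import Data.Nat.Coprimality using (Coprime; coprime-divisor; coprime⇒gcd≡1; prime⇒coprime)
import Data.Nat.Coprimality as Coprime
open import Data.Nat.Primality using (Prime; prime⇒irreducible; ¬prime[0]; ¬prime[1])
open import Data.Nat.ListAction using (sum)
open import Data.Nat.ListAction.Properties using (sum-++)
open import Data.Nat.Tactic.RingSolver using (solve-∀)
open import Data.Product using (Σ; ∃; ∃-syntax; _×_; _,_; proj₁; proj₂)
open import Data.Sum using (_⊎_; inj₁; inj₂)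
import Data.Sum.Properties as Sum
open import Data.Unit using (⊤; tt)
import Data.Unit.Properties as Unit
open import Data.Vec using (Vec; tabulate; lookup)
import Data.Vec.Properties as Vec
open import Relation.Binary.Definitions using (DecidableEquality; tri<; tri≈; tri>)
open import Relation.Binary.PropositionalEquality
open import Relation.Nullary using (¬_; Dec; yes; no; does; contradiction)
open import Relation.Nullary.Decidable using (map′; _×-dec_; ¬?)

-- The proper non-trivial subgroups of D_{2p²} are ⟨r⟩, ⟨rᵖ⟩, the p² groups
-- ⟨rᵏs⟩ = {1, rᵏs} and the p dihedral groups ⟨rᵖ, rᶜs⟩; the classification
-- rests on the fact that a subgroup of ⟨r⟩ ≅ ℤ/p² containing rⁱ contains
-- r^gcd(i,p²). All of them except the ⟨rᵏs⟩ contain rᵖ and so form a clique,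
-- while ⟨rᵏs⟩ meets only ⟨rᵖ, rᶜs⟩ with c = k mod p. Hence two distinct
-- vertices are at distance 1 if they intersect, 2 if some vertex meets both
-- (always, unless they are ⟨rᵏs⟩ and ⟨rˡs⟩ with k ≢ l mod p), and 3 otherwise.
-- Summing over ordered pairs, with the diagonal counted as 1, gives
-- 2W + (p² + p + 2) = 3p⁴ + 3p³ + 6p² + 4p + 4.

private
  variable
    ℓ ℓ′ ℓ″ : Level
    A : Set ℓ
    B : Set ℓ′
    C : Set ℓ″

T⇒≡true : ∀ {x} → T x → x ≡ true
T⇒≡true = Equivalence.to Bool.T-≡

≡true⇒T : ∀ {x} → x ≡ true → T x
≡true⇒T = Equivalence.from Bool.T-≡

∧-≡true⁻ : ∀ {x y} → (x ∧ y) ≡ true → x ≡ true × y ≡ true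
∧-≡true⁻ {true} {true} _ = refl , refl

∧-≡true⁺ : ∀ {x y} → x ≡ true → y ≡ true → (x ∧ y) ≡ true
∧-≡true⁺ refl refl = refl

implication⁺ : ∀ {x y} → (x ≡ true → y ≡ true) → (not x ∨ y) ≡ true
implication⁺ {false} _   = refl
implication⁺ {true}  x⇒y = x⇒y refl

implication⁻ : ∀ {x y} → (not x ∨ y) ≡ true → x ≡ true → y ≡ true
implication⁻ x⇒y refl = x⇒y

implication₂⁺ : ∀ {x y z} → (x ≡ true → y ≡ true → z ≡ true) → (not (x ∧ y) ∨ z) ≡ true
implication₂⁺ {true}  x⇒y⇒z = implication⁺ (x⇒y⇒z refl)
implication₂⁺ {false} _     = refl

implication₂⁻ : ∀ {x y z} → (not (x ∧ y) ∨ z) ≡ true → x ≡ true → y ≡ true → z ≡ true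
implication₂⁻ x∧y⇒z refl refl = x∧y⇒z

bool-ext : ∀ {x y : Bool} → (x ≡ true → y ≡ true) → (y ≡ true → x ≡ true) → x ≡ y
bool-ext {false} {false} _   _   = refl
bool-ext {false} {true}  _   y⇒x = y⇒x refl
bool-ext {true}  {false} x⇒y _   = sym (x⇒y refl)
bool-ext {true}  {true}  _   _   = refl

any-≡true⁻ : (f : A → Bool) (xs : List A) → any f xs ≡ true → ∃ λ x → x ∈ xs × f x ≡ true
any-≡true⁻ f (x ∷ xs) any≡true with f x in fx
... | true  = x , here refl , fx
... | false = let y , y∈ , fy = any-≡true⁻ f xs any≡true in y , there y∈ , fy

any-≡true⁺ : (f : A → Bool) {xs : List A} {x : A} → x ∈ xs → f x ≡ true → any f xs ≡ true
any-≡true⁺ f {x ∷ xs} (here refl) fx rewrite fx = refl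
any-≡true⁺ f {y ∷ xs} (there x∈) fx with f y
... | true  = refl
... | false = any-≡true⁺ f x∈ fx

any-≡false⁺ : (f : A → Bool) (xs : List A) → (∀ x → x ∈ xs → f x ≡ false) → any f xs ≡ false
any-≡false⁺ f []       _  = refl
any-≡false⁺ f (x ∷ xs) f≡false rewrite f≡false x (here refl) =
  any-≡false⁺ f xs (λ y y∈ → f≡false y (there y∈))

any-cong : {f g : A → Bool} (xs : List A) → (∀ x → f x ≡ g x) → any f xs ≡ any g xs
any-cong []       f≗g = refl
any-cong (x ∷ xs) f≗g = cong₂ _∨_ (f≗g x) (any-cong xs f≗g)

all-≡true⁻ : (f : A → Bool) {xs : List A} → all f xs ≡ true → ∀ {x} → x ∈ xs → f x ≡ true
all-≡true⁻ f {y ∷ xs} all≡true (here refl) = proj₁ (∧-≡true⁻ all≡true)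
all-≡true⁻ f {y ∷ xs} all≡true (there x∈)  = all-≡true⁻ f (proj₂ (∧-≡true⁻ {f y} all≡true)) x∈

all-≡true⁺ : (f : A → Bool) (xs : List A) → (∀ x → x ∈ xs → f x ≡ true) → all f xs ≡ true
all-≡true⁺ f []       _ = refl
all-≡true⁺ f (x ∷ xs) f≡true rewrite f≡true x (here refl) =
  all-≡true⁺ f xs (λ y y∈ → f≡true y (there y∈))

≡ᵇ-comm : ∀ m n → (m ≡ᵇ n) ≡ (n ≡ᵇ m)
≡ᵇ-comm zero    zero    = refl
≡ᵇ-comm zero    (suc n) = refl
≡ᵇ-comm (suc m) zero    = refl
≡ᵇ-comm (suc m) (suc n) = ≡ᵇ-comm m n

≡ᵇ-refl : ∀ n → (n ≡ᵇ n) ≡ true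
≡ᵇ-refl zero    = refl
≡ᵇ-refl (suc n) = ≡ᵇ-refl n

≡ᵇ≡true⇒≡ : ∀ {x y} → (x ≡ᵇ y) ≡ true → x ≡ y
≡ᵇ≡true⇒≡ {x} {y} eq = ≡ᵇ⇒≡ x y (≡true⇒T eq)

≡⇒≡ᵇ≡true : ∀ {x y} → x ≡ y → (x ≡ᵇ y) ≡ true
≡⇒≡ᵇ≡true {x} refl = ≡ᵇ-refl x

≢⇒≡ᵇ≡false : ∀ {m n} → m ≢ n → (m ≡ᵇ n) ≡ false
≢⇒≡ᵇ≡false {m} {n} m≢n with m ≡ᵇ n in eq
... | true  = contradiction (≡ᵇ≡true⇒≡ eq) m≢n
... | false = refl

≡ᵇ≡false⇒≢ : ∀ {m n} → (m ≡ᵇ n) ≡ false → m ≢ n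
≡ᵇ≡false⇒≢ {m} m≢ᵇm refl = contradiction (trans (sym (≡ᵇ-refl m)) m≢ᵇm) λ ()

<ᵇ≡false : ∀ {x y} → y ≤ x → (x <ᵇ y) ≡ false
<ᵇ≡false {x} {y} y≤x with x <ᵇ y in eq
... | true  = contradiction (<ᵇ⇒< x y (≡true⇒T eq)) (≤⇒≯ y≤x)
... | false = refl

<ᵇ≡true : ∀ {x y} → x < y → (x <ᵇ y) ≡ true
<ᵇ≡true {x} {y} x<y with x <ᵇ y in eq | <⇒<ᵇ x<y
... | true | _ = refl

ind : Bool → ℕ
ind false = 0
ind true  = 1

ind-∧ : ∀ x y → ind (x ∧ y) ≡ ind x * ind y
ind-∧ true  y = sym (+-identityʳ (ind y))
ind-∧ false y = refl

sumBy : (A → ℕ) → List A → ℕ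
sumBy f []       = 0
sumBy f (x ∷ xs) = f x + sumBy f xs

sum-map : (f : A → ℕ) (xs : List A) → sum (map f xs) ≡ sumBy f xs
sum-map f []       = refl
sum-map f (x ∷ xs) = cong (f x +_) (sum-map f xs)

sum-concatMap : (h : A → List ℕ) (xs : List A) → sum (concatMap h xs) ≡ sumBy (sum ∘ h) xs
sum-concatMap h []       = refl
sum-concatMap h (x ∷ xs) = trans (sum-++ (h x) (concatMap h xs)) (cong (sum (h x) +_) (sum-concatMap h xs))

sumBy-++ : (f : A → ℕ) (xs ys : List A) → sumBy f (xs ++ ys) ≡ sumBy f xs + sumBy f ys
sumBy-++ f []       ys = refl
sumBy-++ f (x ∷ xs) ys = trans (cong (f x +_) (sumBy-++ f xs ys)) (sym (+-assoc (f x) _ _))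

sumBy-map : (f : C → ℕ) (g : A → C) (xs : List A) → sumBy f (map g xs) ≡ sumBy (f ∘ g) xs
sumBy-map f g []       = refl
sumBy-map f g (x ∷ xs) = cong (f (g x) +_) (sumBy-map f g xs)

sumBy-concatMap : (f : C → ℕ) (g : A → List C) (xs : List A) →
                  sumBy f (concatMap g xs) ≡ sumBy (sumBy f ∘ g) xs
sumBy-concatMap f g []       = refl
sumBy-concatMap f g (x ∷ xs) =
  trans (sumBy-++ f (g x) (concatMap g xs)) (cong (sumBy f (g x) +_) (sumBy-concatMap f g xs))

sumBy-filterᵇ : (f : A → ℕ) (P : A → Bool) (xs : List A) →
                sumBy f (filterᵇ P xs) ≡ sumBy (λ x → ind (P x) * f x) xs
sumBy-filterᵇ f P []       = refl
sumBy-filterᵇ f P (x ∷ xs) with P x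
... | true  = cong₂ _+_ (sym (+-identityʳ (f x))) (sumBy-filterᵇ f P xs)
... | false = sumBy-filterᵇ f P xs

sumBy-cong : {f g : A → ℕ} (xs : List A) → (∀ x → x ∈ xs → f x ≡ g x) → sumBy f xs ≡ sumBy g xs
sumBy-cong []       f≗g = refl
sumBy-cong (x ∷ xs) f≗g = cong₂ _+_ (f≗g x (here refl)) (sumBy-cong xs (λ y y∈ → f≗g y (there y∈)))

sumBy-+ : (f g : A → ℕ) (xs : List A) → sumBy (λ x → f x + g x) xs ≡ sumBy f xs + sumBy g xs
sumBy-+ f g []       = refl
sumBy-+ f g (x ∷ xs) rewrite sumBy-+ f g xs = interchange (f x) (g x) (sumBy f xs) (sumBy g xs)
  where
  interchange : ∀ w x y z → w + x + (y + z) ≡ w + y + (x + z)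
  interchange = solve-∀

sumBy-*ˡ : (k : ℕ) (f : A → ℕ) (xs : List A) → sumBy (λ x → k * f x) xs ≡ k * sumBy f xs
sumBy-*ˡ k f []       = sym (*-zeroʳ k)
sumBy-*ˡ k f (x ∷ xs) rewrite sumBy-*ˡ k f xs = sym (*-distribˡ-+ k (f x) (sumBy f xs))

sumBy-*ʳ : (k : ℕ) (f : A → ℕ) (xs : List A) → sumBy (λ x → f x * k) xs ≡ sumBy f xs * k
sumBy-*ʳ k f []       = refl
sumBy-*ʳ k f (x ∷ xs) rewrite sumBy-*ʳ k f xs = sym (*-distribʳ-+ k (f x) (sumBy f xs))

sumBy-const : (k : ℕ) (xs : List A) → sumBy (λ _ → k) xs ≡ length xs * k
sumBy-const k []       = refl
sumBy-const k (x ∷ xs) = cong (k +_) (sumBy-const k xs)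

sumBy-const-downFrom : (k n : ℕ) → sumBy (λ _ → k) (downFrom n) ≡ n * k
sumBy-const-downFrom k n = trans (sumBy-const k (downFrom n)) (cong (_* k) (length-downFrom n))

sumBy-complementary-downFrom : ∀ (f g : ℕ → ℕ) N k → (∀ x → x < N → f x + g x ≡ k) →
                               sumBy f (downFrom N) + sumBy g (downFrom N) ≡ N * k
sumBy-complementary-downFrom f g N k f+g≡k =
  trans (sym (sumBy-+ f g (downFrom N)))
        (trans (sumBy-cong (downFrom N) (λ x x∈ → f+g≡k x (∈-downFrom⁻ x∈))) (sumBy-const-downFrom k N))

sumBy-zero : {f : A → ℕ} (xs : List A) → (∀ x → x ∈ xs → f x ≡ 0) → sumBy f xs ≡ 0
sumBy-zero xs f≡0 = trans (sumBy-cong xs f≡0) (trans (sumBy-const 0 xs) (*-zeroʳ (length xs)))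

sumBy-swap : (f : A → C → ℕ) (xs : List A) (ys : List C) →
             sumBy (λ x → sumBy (f x) ys) xs ≡ sumBy (λ y → sumBy (λ x → f x y) xs) ys
sumBy-swap f []       ys = sym (sumBy-zero ys (λ _ _ → refl))
sumBy-swap f (x ∷ xs) ys =
  trans (cong (sumBy (f x) ys +_) (sumBy-swap f xs ys)) (sym (sumBy-+ (f x) _ ys))

sumBy-downFrom-+ : (f : ℕ → ℕ) (m n : ℕ) →
                   sumBy f (downFrom (m + n)) ≡ sumBy (λ i → f (n + i)) (downFrom m) + sumBy f (downFrom n)
sumBy-downFrom-+ f zero    n = refl
sumBy-downFrom-+ f (suc m) n =
  trans (cong₂ _+_ (cong f (+-comm m n)) (sumBy-downFrom-+ f m n)) (sym (+-assoc (f (n + m)) _ _))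

sumBy-tabulate : ∀ {n} (f : A → ℕ) (g : Fin n → A) → sumBy f (List.tabulate g) ≡ sumBy (f ∘ g) (allFin n)
sumBy-tabulate {n = zero}  f g = refl
sumBy-tabulate {n = suc n} f g =
  cong (f (g fzero) +_) (trans (sumBy-tabulate f (g ∘ fsuc)) (sym (sumBy-tabulate (f ∘ g) fsuc)))

sumBy-lookup : (xs : List A) (f : A → ℕ) → sumBy (f ∘ List.lookup xs) (allFin (length xs)) ≡ sumBy f xs
sumBy-lookup []       f = refl
sumBy-lookup (x ∷ xs) f =
  cong (f x +_) (trans (sumBy-tabulate (f ∘ List.lookup (x ∷ xs)) fsuc) (sumBy-lookup xs f))

count-downFrom : ∀ {m n} → m < n → sumBy (λ k → ind (k ≡ᵇ m)) (downFrom n) ≡ 1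
count-downFrom {m} {suc n} m<1+n with n ≟ m
... | yes refl rewrite ≡ᵇ-refl n =
  cong suc (sumBy-zero (downFrom n) (λ k k∈ → cong ind (≢⇒≡ᵇ≡false (<⇒≢ (∈-downFrom⁻ k∈)))))
... | no n≢m rewrite ≢⇒≡ᵇ≡false n≢m = count-downFrom (≤∧≢⇒< (≤-pred m<1+n) (n≢m ∘ sym))

count-residue : ∀ p .{{_ : NonZero p}} {r} → r < p → ∀ t →
                sumBy (λ k → ind (k % p ≡ᵇ r)) (downFrom (t * p)) ≡ t
count-residue p r<p zero    = refl
count-residue p {r} r<p (suc t) = begin
  sumBy F (downFrom (p + t * p))                               ≡⟨ sumBy-downFrom-+ F p (t * p) ⟩
  sumBy (λ i → F (t * p + i)) (downFrom p) + sumBy F (downFrom (t * p))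
    ≡⟨ cong₂ _+_ (trans (sumBy-cong (downFrom p) last-block) (count-downFrom r<p)) (count-residue p r<p t) ⟩
  suc t                                                        ∎
  where
  open ≡-Reasoning
  F : ℕ → ℕ
  F k = ind (k % p ≡ᵇ r)
  last-block : ∀ i → i ∈ downFrom p → F (t * p + i) ≡ ind (i ≡ᵇ r)
  last-block i i∈ = cong (λ x → ind (x ≡ᵇ r))
    (trans (%-remove-+ˡ i (divides t refl)) (m<n⇒m%n≡m (∈-downFrom⁻ i∈)))

module _ {A : Set ℓ} (_≟_ : DecidableEquality A) where

  δ : A → A → ℕ
  δ x y = ind (does (x ≟ y))

  δ-sym : ∀ x y → δ x y ≡ δ y x
  δ-sym x y with x ≟ y | y ≟ x
  ... | yes _    | yes _    = refl
  ... | no  _    | no  _    = refl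
  ... | yes refl | no  x≢x  = contradiction refl x≢x
  ... | no  x≢x  | yes refl = contradiction refl x≢x

  δ-subst : ∀ x y (h : A → ℕ) → δ x y * h x ≡ δ x y * h y
  δ-subst x y h with x ≟ y
  ... | yes refl = refl
  ... | no  _    = refl

  δ-≢ : ∀ {x y} → x ≢ y → δ x y ≡ 0
  δ-≢ {x} {y} x≢y with x ≟ y
  ... | yes x≡y = contradiction x≡y x≢y
  ... | no  _   = refl

  Enumerates : List A → Set ℓ
  Enumerates xs = ∀ y → sumBy (λ x → δ x y) xs ≡ 1

  sumBy-filterᵇ-image : ∀ {xs} → Enumerates xs → (P : A → Bool) (f : C → A) (cs : List C) →
                        (∀ x → ind (P x) ≡ sumBy (λ c → δ (f c) x) cs) →
                        ∀ h → sumBy h (filterᵇ P xs) ≡ sumBy (h ∘ f) cs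
  sumBy-filterᵇ-image {xs = xs} xs-enum P f cs P≡image h = begin
    sumBy h (filterᵇ P xs)                                    ≡⟨ sumBy-filterᵇ h P xs ⟩
    sumBy (λ x → ind (P x) * h x) xs                          ≡⟨ sumBy-cong xs (λ x _ → cong (_* h x) (P≡image x)) ⟩
    sumBy (λ x → sumBy (λ c → δ (f c) x) cs * h x) xs         ≡⟨ sumBy-cong xs (λ x _ → sym (sumBy-*ʳ (h x) _ cs)) ⟩
    sumBy (λ x → sumBy (λ c → δ (f c) x * h x) cs) xs         ≡⟨ sumBy-cong xs (λ x _ → sumBy-cong cs (λ c _ → move x c)) ⟩
    sumBy (λ x → sumBy (λ c → δ x (f c) * h (f c)) cs) xs     ≡⟨ sumBy-swap (λ x c → δ x (f c) * h (f c)) xs cs ⟩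
    sumBy (λ c → sumBy (λ x → δ x (f c) * h (f c)) xs) cs     ≡⟨ sumBy-cong cs (λ c _ → sumBy-*ʳ (h (f c)) _ xs) ⟩
    sumBy (λ c → sumBy (λ x → δ x (f c)) xs * h (f c)) cs     ≡⟨ sumBy-cong cs (λ c _ → cong (_* h (f c)) (xs-enum (f c))) ⟩
    sumBy (λ c → 1 * h (f c)) cs                              ≡⟨ sumBy-cong cs (λ c _ → *-identityˡ (h (f c))) ⟩
    sumBy (h ∘ f) cs                                          ∎
    where
    open ≡-Reasoning
    move : ∀ x c → δ (f c) x * h x ≡ δ x (f c) * h (f c)
    move x c = trans (cong (_* h x) (δ-sym (f c) x)) (δ-subst x (f c) h)

count-allFin : ∀ {m} (i : Fin m) → sumBy (λ j → δ Fin._≟_ j i) (allFin m) ≡ 1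
count-allFin {suc m} fzero    =
  cong suc (trans (sumBy-tabulate {n = m} (λ j → δ Fin._≟_ j fzero) fsuc) (sumBy-zero (allFin m) (λ _ _ → refl)))
count-allFin {suc m} (fsuc i) =
  trans (sumBy-tabulate {n = m} (λ j → δ Fin._≟_ j (fsuc i)) fsuc) (trans (sumBy-cong (allFin m) (λ j _ → δ-fsuc j)) (count-allFin i))
  where
  δ-fsuc : ∀ j → δ Fin._≟_ (fsuc j) (fsuc i) ≡ δ Fin._≟_ j i
  δ-fsuc j with j Fin.≟ i
  ... | yes _ = refl
  ... | no  _ = refl

δ-injective : (_≟A_ : DecidableEquality A) (_≟B_ : DecidableEquality B) {f : A → B} {x y : A} →
              (f x ≡ f y → x ≡ y) → δ _≟B_ (f x) (f y) ≡ δ _≟A_ x y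
δ-injective _≟A_ _≟B_ {f} {x} {y} f-inj with f x ≟B f y | x ≟A y
... | yes _      | yes _    = refl
... | no  _      | no  _    = refl
... | yes fx≡fy  | no  x≢y  = contradiction (f-inj fx≡fy) x≢y
... | no  fx≢fy  | yes refl = contradiction refl fx≢fy

coprime-* : ∀ {a m n} → Coprime a m → Coprime a n → Coprime a (m * n)
coprime-* {a} {m} {n} a⊥m a⊥n {d} (d∣a , d∣mn) = a⊥n (d∣a , coprime-divisor d⊥m d∣mn)
  where
  d⊥m : Coprime d m
  d⊥m (e∣d , e∣m) = a⊥m (∣-trans e∣d d∣a , e∣m)

∤⇒coprime : ∀ {p a} → Prime p → ¬ p ∣ a → Coprime a p
∤⇒coprime pr p∤a (d∣a , d∣p) with prime⇒irreducible pr d∣p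
... | inj₁ d≡1  = d≡1
... | inj₂ refl = contradiction d∣a p∤a

∈-concatMap⁺′ : (g : A → List B) {x : A} {y : B} {xs : List A} → x ∈ xs → y ∈ g x → y ∈ concatMap g xs
∈-concatMap⁺′ g {xs = x ∷ xs} (here refl) y∈ = ∈-++⁺ˡ y∈
∈-concatMap⁺′ g {xs = z ∷ xs} (there x∈)  y∈ = ∈-++⁺ʳ (g z) (∈-concatMap⁺′ g x∈ y∈)

elems-complete : ∀ n (x : D n) → x ∈ elems n
elems-complete n (i , false) = ∈-++⁺ˡ (∈-map⁺ (λ i → i , false) (∈-allFin i))
elems-complete n (i , true)  = ∈-++⁺ʳ (map (λ i → i , false) (allFin n)) (∈-map⁺ (λ i → i , true) (∈-allFin i))

vecs-complete : ∀ k (v : Vec Bool k) → v ∈ vecs k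
vecs-complete zero    Vec.[]          = here refl
vecs-complete (suc k) (false Vec.∷ v) = ∈-concatMap⁺′ _ (vecs-complete k v) (here refl)
vecs-complete (suc k) (true  Vec.∷ v) = ∈-concatMap⁺′ _ (vecs-complete k v) (there (here refl))

subsets-complete : ∀ n (H : Sub n) → H ∈ subsets n
subsets-complete n (R , S) = ∈-concatMap⁺′ _ (vecs-complete n R) (∈-map⁺ (R ,_) (vecs-complete n S))

tabulate-lookup-≗ : ∀ {k} (V : Vec Bool k) {f : Fin k → Bool} → (∀ i → lookup V i ≡ f i) → V ≡ tabulate f
tabulate-lookup-≗ V V≗f = trans (sym (Vec.tabulate∘lookup V)) (Vec.tabulate-cong V≗f)

_≟ᵛ_ : ∀ {k} → DecidableEquality (Vec Bool k)
_≟ᵛ_ = Vec.≡-dec Bool._≟_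

_≟ˢ_ : ∀ {n} → DecidableEquality (Sub n)
(R , S) ≟ˢ (R′ , S′) =
  map′ (λ (R≡ , S≡) → cong₂ _,_ R≡ S≡) (λ { refl → refl , refl }) (R ≟ᵛ R′ ×-dec S ≟ᵛ S′)

vecs-enumerates : ∀ k → Enumerates _≟ᵛ_ (vecs k)
vecs-enumerates zero    Vec.[]          = refl
vecs-enumerates (suc k) (b Vec.∷ w) =
  trans (sumBy-concatMap (λ v → δ _≟ᵛ_ v (b Vec.∷ w)) _ (vecs k))
        (trans (sumBy-cong (vecs k) (λ v _ → one-head b v)) (vecs-enumerates k w))
  where
  one-head : ∀ b v → δ _≟ᵛ_ (false Vec.∷ v) (b Vec.∷ w) + (δ _≟ᵛ_ (true Vec.∷ v) (b Vec.∷ w) + 0) ≡ δ _≟ᵛ_ v w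
  one-head false v = +-identityʳ _
  one-head true  v = +-identityʳ _

subsets-enumerates : ∀ n → Enumerates _≟ˢ_ (subsets n)
subsets-enumerates n (R′ , S′) = begin
  sumBy (λ H → δ _≟ˢ_ H (R′ , S′)) (subsets n)
    ≡⟨ sumBy-concatMap _ _ (vecs n) ⟩
  sumBy (λ R → sumBy (λ H → δ _≟ˢ_ H (R′ , S′)) (map (R ,_) (vecs n))) (vecs n)
    ≡⟨ sumBy-cong (vecs n) (λ R _ → sumBy-map _ (R ,_) (vecs n)) ⟩
  sumBy (λ R → sumBy (λ S → ind (does (R ≟ᵛ R′) ∧ does (S ≟ᵛ S′))) (vecs n)) (vecs n)
    ≡⟨ sumBy-cong (vecs n) (λ R _ → sumBy-cong (vecs n) (λ S _ → ind-∧ (does (R ≟ᵛ R′)) _)) ⟩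
  sumBy (λ R → sumBy (λ S → δ _≟ᵛ_ R R′ * δ _≟ᵛ_ S S′) (vecs n)) (vecs n)
    ≡⟨ sumBy-cong (vecs n) (λ R _ → sumBy-*ˡ (δ _≟ᵛ_ R R′) _ (vecs n)) ⟩
  sumBy (λ R → δ _≟ᵛ_ R R′ * sumBy (λ S → δ _≟ᵛ_ S S′) (vecs n)) (vecs n)
    ≡⟨ sumBy-cong (vecs n) (λ R _ → cong (δ _≟ᵛ_ R R′ *_) (vecs-enumerates n S′)) ⟩
  sumBy (λ R → δ _≟ᵛ_ R R′ * 1) (vecs n)
    ≡⟨ sumBy-cong (vecs n) (λ R _ → *-identityʳ _) ⟩
  sumBy (λ R → δ _≟ᵛ_ R R′) (vecs n)
    ≡⟨ vecs-enumerates n R′ ⟩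
  1 ∎
  where open ≡-Reasoning

-- Arithmetic in ℤ/N

module _ {m : ℕ} where

  private
    N = suc m

  infixl 6 _⊕_ _⊖_

  _⊕_ : Fin N → Fin N → Fin N
  _⊕_ = addMod

  _⊖_ : Fin N → Fin N → Fin N
  i ⊖ j = addMod i (negMod j)

  toℕ-⊕ : ∀ i j → toℕ (i ⊕ j) ≡ (toℕ i + toℕ j) % N
  toℕ-⊕ i j = Fin.toℕ-fromℕ< _

  toℕ-negMod : ∀ j → toℕ (negMod j) ≡ (N ∸ toℕ j) % N
  toℕ-negMod j = Fin.toℕ-fromℕ< _

  toℕ%N : ∀ i → toℕ i % N ≡ toℕ i
  toℕ%N i = m<n⇒m%n≡m (Fin.toℕ<n i)

  toℕ≤N : ∀ (i : Fin N) → toℕ i ≤ N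
  toℕ≤N i = <⇒≤ (Fin.toℕ<n i)

  module Residues (g : ℕ) .{{_ : NonZero g}} (g∣N : g ∣ N) where

    %N%g : ∀ x → x % N % g ≡ x % g
    %N%g x = m∣n⇒o%n%m≡o%m g N x g∣N

    +%N%g : ∀ x y → (x + y % N) % g ≡ (x + y) % g
    +%N%g x y = begin
      (x + y % N) % g             ≡⟨ %-distribˡ-+ x (y % N) g ⟩
      (x % g + y % N % g) % g     ≡⟨ cong (λ z → (x % g + z) % g) (%N%g y) ⟩
      (x % g + y % g) % g         ≡⟨ %-distribˡ-+ x y g ⟨
      (x + y) % g                 ∎
      where open ≡-Reasoning

    N∸-%≡0 : ∀ {y} → y ≤ N → y % g ≡ 0 → (N ∸ y) % g ≡ 0
    N∸-%≡0 {y} y≤N y%g≡0 = begin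
      (N ∸ y) % g     ≡⟨ %-remove-+ʳ (N ∸ y) (m%n≡0⇒n∣m y g y%g≡0) ⟨
      (N ∸ y + y) % g ≡⟨ cong (_% g) (m∸n+n≡m y≤N) ⟩
      N % g           ≡⟨ n∣m⇒m%n≡0 N g g∣N ⟩
      0               ∎
      where open ≡-Reasoning

    +N∸-%≡0⁺ : ∀ x {y} → y ≤ N → x % g ≡ y % g → (x + (N ∸ y)) % g ≡ 0
    +N∸-%≡0⁺ x {y} y≤N x≡y = begin
      (x + (N ∸ y)) % g             ≡⟨ %-distribˡ-+ x (N ∸ y) g ⟩
      (x % g + (N ∸ y) % g) % g     ≡⟨ cong (λ z → (z + (N ∸ y) % g) % g) x≡y ⟩
      (y % g + (N ∸ y) % g) % g     ≡⟨ %-distribˡ-+ y (N ∸ y) g ⟨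
      (y + (N ∸ y)) % g             ≡⟨ cong (_% g) (m+[n∸m]≡n y≤N) ⟩
      N % g                         ≡⟨ n∣m⇒m%n≡0 N g g∣N ⟩
      0                             ∎
      where open ≡-Reasoning

    +N∸-%≡0⁻ : ∀ x {y} → y ≤ N → (x + (N ∸ y)) % g ≡ 0 → x % g ≡ y % g
    +N∸-%≡0⁻ x {y} y≤N x-y≡0 = begin
      x % g                       ≡⟨ %-remove-+ʳ x g∣N ⟨
      (x + N) % g                 ≡⟨ cong (λ z → (x + z) % g) (m∸n+n≡m y≤N) ⟨
      (x + (N ∸ y + y)) % g       ≡⟨ cong (_% g) (+-assoc x (N ∸ y) y) ⟨
      (x + (N ∸ y) + y) % g       ≡⟨ %-remove-+ˡ y (m%n≡0⇒n∣m _ g x-y≡0) ⟩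
      y % g                       ∎
      where open ≡-Reasoning

    ⊕-% : ∀ i j → toℕ (i ⊕ j) % g ≡ (toℕ i + toℕ j) % g
    ⊕-% i j = trans (cong (_% g) (toℕ-⊕ i j)) (%N%g _)

    negMod-% : ∀ j → toℕ (negMod j) % g ≡ (N ∸ toℕ j) % g
    negMod-% j = trans (cong (_% g) (toℕ-negMod j)) (%N%g _)

    ⊖-% : ∀ i j → toℕ (i ⊖ j) % g ≡ (toℕ i + (N ∸ toℕ j)) % g
    ⊖-% i j = trans (⊕-% i (negMod j)) (trans (cong (λ z → (toℕ i + z) % g) (toℕ-negMod j)) (+%N%g (toℕ i) (N ∸ toℕ j)))

    ⊕-%-zeroˡ : ∀ i j → toℕ i % g ≡ 0 → toℕ (i ⊕ j) % g ≡ toℕ j % g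
    ⊕-%-zeroˡ i j i≡0 = trans (⊕-% i j) (%-remove-+ˡ (toℕ j) (m%n≡0⇒n∣m (toℕ i) g i≡0))

    negMod-%-zero : ∀ j → toℕ j % g ≡ 0 → toℕ (negMod j) % g ≡ 0
    negMod-%-zero j j≡0 = trans (negMod-% j) (N∸-%≡0 (toℕ≤N j) j≡0)

    ⊖-%-zeroʳ : ∀ i j → toℕ j % g ≡ 0 → toℕ (i ⊖ j) % g ≡ toℕ i % g
    ⊖-%-zeroʳ i j j≡0 = trans (⊖-% i j)
      (%-remove-+ʳ (toℕ i) (m%n≡0⇒n∣m (N ∸ toℕ j) g (N∸-%≡0 (toℕ≤N j) j≡0)))

    ⊖-%≡0⁺ : ∀ i j → toℕ i % g ≡ toℕ j % g → toℕ (i ⊖ j) % g ≡ 0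
    ⊖-%≡0⁺ i j i≡j = trans (⊖-% i j) (+N∸-%≡0⁺ (toℕ i) (toℕ≤N j) i≡j)

    ⊖-%≡0⁻ : ∀ i j → toℕ (i ⊖ j) % g ≡ 0 → toℕ i % g ≡ toℕ j % g
    ⊖-%≡0⁻ i j i-j≡0 = +N∸-%≡0⁻ (toℕ i) (toℕ≤N j) (trans (sym (⊖-% i j)) i-j≡0)

  open Residues N ∣-refl using (+%N%g; +N∸-%≡0⁻) renaming (⊕-% to ⊕-%N; ⊖-% to ⊖-%N)

  ⊖-⊕-cancel : ∀ i j → i ⊖ j ⊕ j ≡ i
  ⊖-⊕-cancel i j = Fin.toℕ-injective (begin
    toℕ (i ⊖ j ⊕ j)                          ≡⟨ toℕ%N (i ⊖ j ⊕ j) ⟨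
    toℕ (i ⊖ j ⊕ j) % N                      ≡⟨ ⊕-%N (i ⊖ j) j ⟩
    (toℕ (i ⊖ j) + toℕ j) % N                ≡⟨ %-distribˡ-+ (toℕ (i ⊖ j)) (toℕ j) N ⟩
    (toℕ (i ⊖ j) % N + toℕ j % N) % N        ≡⟨ cong (λ z → (z + toℕ j % N) % N) (⊖-%N i j) ⟩
    ((toℕ i + (N ∸ toℕ j)) % N + toℕ j % N) % N ≡⟨ %-distribˡ-+ (toℕ i + (N ∸ toℕ j)) (toℕ j) N ⟨
    (toℕ i + (N ∸ toℕ j) + toℕ j) % N        ≡⟨ cong (_% N) (trans (+-assoc (toℕ i) _ _)
                                                                (cong (toℕ i +_) (m∸n+n≡m (toℕ≤N j)))) ⟩
    (toℕ i + N) % N                          ≡⟨ %-remove-+ʳ (toℕ i) ∣-refl ⟩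
    toℕ i % N                                ≡⟨ toℕ%N i ⟩
    toℕ i                                    ∎)
    where open ≡-Reasoning

  ofℕ : ℕ → Fin N
  ofℕ k = k mod N

  toℕ-ofℕ : ∀ k → toℕ (ofℕ k) ≡ k % N
  toℕ-ofℕ k = Fin.toℕ-fromℕ< _

  toℕ-ofℕ-< : ∀ {k} → k < N → toℕ (ofℕ k) ≡ k
  toℕ-ofℕ-< {k} k<N = trans (toℕ-ofℕ k) (m<n⇒m%n≡m k<N)

  ofℕ-cong-% : ∀ {k l} → k % N ≡ l % N → ofℕ k ≡ ofℕ l
  ofℕ-cong-% {k} {l} k≡l = Fin.toℕ-injective (trans (toℕ-ofℕ k) (trans k≡l (sym (toℕ-ofℕ l))))

  ⊕-ofℕ : ∀ i k → i ⊕ ofℕ k ≡ ofℕ (toℕ i + k)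
  ⊕-ofℕ i k = Fin.toℕ-injective (begin
    toℕ (i ⊕ ofℕ k)              ≡⟨ toℕ-⊕ i (ofℕ k) ⟩
    (toℕ i + toℕ (ofℕ k)) % N    ≡⟨ cong (λ z → (toℕ i + z) % N) (toℕ-ofℕ k) ⟩
    (toℕ i + k % N) % N          ≡⟨ +%N%g (toℕ i) k ⟩
    (toℕ i + k) % N              ≡⟨ toℕ-ofℕ (toℕ i + k) ⟨
    toℕ (ofℕ (toℕ i + k))        ∎)
    where open ≡-Reasoning

  negMod-ofℕ : ∀ d k → (d + k) % N ≡ 0 → negMod (ofℕ k) ≡ ofℕ d
  negMod-ofℕ d k d+k≡0 = Fin.toℕ-injective (begin
    toℕ (negMod (ofℕ k))         ≡⟨ toℕ-negMod (ofℕ k) ⟩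
    (N ∸ toℕ (ofℕ k)) % N        ≡⟨ +N∸-%≡0⁻ d (m∸n≤m N (toℕ (ofℕ k))) d+[N∸[N∸k]]≡0 ⟨
    d % N                        ≡⟨ toℕ-ofℕ d ⟨
    toℕ (ofℕ d)                  ∎)
    where
    open ≡-Reasoning
    d+[N∸[N∸k]]≡0 : (d + (N ∸ (N ∸ toℕ (ofℕ k)))) % N ≡ 0
    d+[N∸[N∸k]]≡0 = begin
      (d + (N ∸ (N ∸ toℕ (ofℕ k)))) % N  ≡⟨ cong (λ z → (d + z) % N) (m∸[m∸n]≡n (toℕ≤N (ofℕ k))) ⟩
      (d + toℕ (ofℕ k)) % N              ≡⟨ cong (λ z → (d + z) % N) (toℕ-ofℕ k) ⟩
      (d + k % N) % N                    ≡⟨ +%N%g d k ⟩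
      (d + k) % N                        ≡⟨ d+k≡0 ⟩
      0                                  ∎

-- Subgroups of D_{2N}

module _ {m : ℕ} where

  private
    N = suc m

  -- ρ and σ are the characteristic functions of the rotations rⁱ and of the
  -- reflections rⁱs of a subset; the fields are closure under the four kinds of
  -- products rⁱsᵃ · rʲsᵇ and under inversion (reflections are involutions).
  record SubgroupLaws (ρ σ : Fin N → Bool) : Set where
    field
      ρ-identity : ρ fzero ≡ true
      ρ-inverse  : ∀ i → ρ i ≡ true → ρ (negMod i) ≡ true
      ρρ-closed  : ∀ i j → ρ i ≡ true → ρ j ≡ true → ρ (i ⊕ j) ≡ true
      ρσ-closed  : ∀ i j → ρ i ≡ true → σ j ≡ true → σ (i ⊕ j) ≡ true
      σρ-closed  : ∀ i j → σ i ≡ true → ρ j ≡ true → σ (i ⊖ j) ≡ true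
      σσ-closed  : ∀ i j → σ i ≡ true → σ j ≡ true → ρ (i ⊖ j) ≡ true

  SubgroupLaws-≗ : ∀ {ρ σ ρ′ σ′ : Fin N → Bool} → (∀ i → ρ i ≡ ρ′ i) → (∀ i → σ i ≡ σ′ i) →
                   SubgroupLaws ρ σ → SubgroupLaws ρ′ σ′
  SubgroupLaws-≗ {ρ} {σ} ρ≗ σ≗ laws = record
    { ρ-identity = to ρ≗ ρ-identity
    ; ρ-inverse  = λ i ρi → to ρ≗ (ρ-inverse i (from ρ≗ ρi))
    ; ρρ-closed  = λ i j ρi ρj → to ρ≗ (ρρ-closed i j (from ρ≗ ρi) (from ρ≗ ρj))
    ; ρσ-closed  = λ i j ρi σj → to σ≗ (ρσ-closed i j (from ρ≗ ρi) (from σ≗ σj))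
    ; σρ-closed  = λ i j σi ρj → to σ≗ (σρ-closed i j (from σ≗ σi) (from ρ≗ ρj))
    ; σσ-closed  = λ i j σi σj → to ρ≗ (σσ-closed i j (from σ≗ σi) (from σ≗ σj))
    }
    where
    open SubgroupLaws laws
    to : ∀ {f g : Fin N → Bool} {i} → (∀ i → f i ≡ g i) → f i ≡ true → g i ≡ true
    to {i = i} f≗g fi = trans (sym (f≗g i)) fi
    from : ∀ {f g : Fin N → Bool} {i} → (∀ i → f i ≡ g i) → g i ≡ true → f i ≡ true
    from {i = i} f≗g gi = trans (f≗g i) gi

  module _ {R S : Vec Bool N} where

    private
      H : Sub N
      H = R , S

    isSubgroup⁺ : SubgroupLaws (lookup R) (lookup S) → isSubgroup H ≡ true
    isSubgroup⁺ laws = ∧-≡true⁺ has-identity (∧-≡true⁺ (all-≡true⁺ _ (elems N) λ x _ →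
                                                         all-≡true⁺ _ (elems N) λ y _ → product-closed x y)
                                                       (all-≡true⁺ _ (elems N) λ x _ → inverse-closed x))
      where
      open SubgroupLaws laws
      has-identity : any (λ x → isId x ∧ mem x H) (elems N) ≡ true
      has-identity = any-≡true⁺ (λ x → isId x ∧ mem x H) (elems-complete N (fzero , false)) ρ-identity
      product-closed : ∀ x y → (not (mem x H ∧ mem y H) ∨ mem (x · y) H) ≡ true
      product-closed (i , false) (j , false) = implication₂⁺ (ρρ-closed i j)
      product-closed (i , false) (j , true)  = implication₂⁺ (ρσ-closed i j)
      product-closed (i , true)  (j , false) = implication₂⁺ (σρ-closed i j)
      product-closed (i , true)  (j , true)  = implication₂⁺ (σσ-closed i j)
      inverse-closed : ∀ x → (not (mem x H) ∨ mem (inv x) H) ≡ true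
      inverse-closed (i , false) = implication⁺ (ρ-inverse i)
      inverse-closed (i , true)  = implication⁺ {lookup S i} id

    isSubgroup⁻ : isSubgroup H ≡ true → SubgroupLaws (lookup R) (lookup S)
    isSubgroup⁻ H≤ = record
      { ρ-identity = ρ-identity
      ; ρ-inverse  = λ i → inverse-closed (i , false)
      ; ρρ-closed  = λ i j → product-closed (i , false) (j , false)
      ; ρσ-closed  = λ i j → product-closed (i , false) (j , true)
      ; σρ-closed  = λ i j → product-closed (i , true) (j , false)
      ; σσ-closed  = λ i j → product-closed (i , true) (j , true)
      }
      where
      Identity Products Inverses : Bool
      Identity = any (λ x → isId x ∧ mem x H) (elems N)
      Products = all (λ x → all (λ y → not (mem x H ∧ mem y H) ∨ mem (x · y) H) (elems N)) (elems N)
      Inverses = all (λ x → not (mem x H) ∨ mem (inv x) H) (elems N)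
      has-identity : Identity ≡ true
      has-identity = proj₁ (∧-≡true⁻ H≤)
      has-products : Products ≡ true
      has-products = proj₁ (∧-≡true⁻ (proj₂ (∧-≡true⁻ {Identity} H≤)))
      has-inverses : Inverses ≡ true
      has-inverses = proj₂ (∧-≡true⁻ {Products} (proj₂ (∧-≡true⁻ {Identity} H≤)))
      product-closed : ∀ x y → mem x H ≡ true → mem y H ≡ true → mem (x · y) H ≡ true
      product-closed x y = implication₂⁻
        (all-≡true⁻ _ (all-≡true⁻ (λ x → all (λ y → not (mem x H ∧ mem y H) ∨ mem (x · y) H) (elems N))
                                  has-products (elems-complete N x))
                      (elems-complete N y))
      inverse-closed : ∀ x → mem x H ≡ true → mem (inv x) H ≡ true
      inverse-closed x = implication⁻ (all-≡true⁻ (λ x → not (mem x H) ∨ mem (inv x) H) has-inverses (elems-complete N x))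
      ρ-identity : lookup R fzero ≡ true
      ρ-identity with any-≡true⁻ (λ x → isId x ∧ mem x H) (elems N) has-identity
      ... | (i , false) , _ , i≡1 with ∧-≡true⁻ {isId (i , false)} i≡1
      ...   | i≡0 , Ri rewrite Fin.toℕ-injective {i = i} {j = fzero} (≡ᵇ≡true⇒≡ i≡0) = Ri
      ρ-identity | (i , true) , _ , ()

  residue : (g : ℕ) .{{_ : NonZero g}} → ℕ → Fin N → Bool
  residue g c i = toℕ i % g ≡ᵇ c

  module _ (g : ℕ) .{{_ : NonZero g}} (g∣N : g ∣ N) where

    open Residues g g∣N

    coset-laws : ∀ c → SubgroupLaws (residue g 0) (residue g c)
    coset-laws c = record
      { ρ-identity = ≡⇒≡ᵇ≡true (m*n%n≡0 0 g)
      ; ρ-inverse  = λ i ρi → ≡⇒≡ᵇ≡true (negMod-%-zero i (≡ᵇ≡true⇒≡ ρi))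
      ; ρρ-closed  = λ i j ρi ρj → ≡⇒≡ᵇ≡true (trans (⊕-%-zeroˡ i j (≡ᵇ≡true⇒≡ ρi)) (≡ᵇ≡true⇒≡ ρj))
      ; ρσ-closed  = λ i j ρi σj → ≡⇒≡ᵇ≡true (trans (⊕-%-zeroˡ i j (≡ᵇ≡true⇒≡ ρi)) (≡ᵇ≡true⇒≡ σj))
      ; σρ-closed  = λ i j σi ρj → ≡⇒≡ᵇ≡true (trans (⊖-%-zeroʳ i j (≡ᵇ≡true⇒≡ ρj)) (≡ᵇ≡true⇒≡ σi))
      ; σσ-closed  = λ i j σi σj → ≡⇒≡ᵇ≡true (⊖-%≡0⁺ i j (trans (≡ᵇ≡true⇒≡ σi) (sym (≡ᵇ≡true⇒≡ σj))))
      }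

    cyclic-laws : SubgroupLaws (residue g 0) (λ _ → false)
    cyclic-laws = record
      { ρ-identity = ρ-identity
      ; ρ-inverse  = ρ-inverse
      ; ρρ-closed  = ρρ-closed
      ; ρσ-closed  = λ _ _ _ ()
      ; σρ-closed  = λ _ _ ()
      ; σσ-closed  = λ _ _ ()
      }
      where open SubgroupLaws (coset-laws 0)

  module _ {ρ σ : Fin N → Bool} (laws : SubgroupLaws ρ σ) where

    open SubgroupLaws laws

    multiple-closed : ∀ i → ρ i ≡ true → ∀ t → ρ (ofℕ (t * toℕ i)) ≡ true
    multiple-closed i ρi zero    = ρ-identity
    multiple-closed i ρi (suc t) =
      subst (λ j → ρ j ≡ true) (⊕-ofℕ i (t * toℕ i)) (ρρ-closed i _ ρi (multiple-closed i ρi t))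

    gcd-closed : ∀ i → ρ i ≡ true → ρ (ofℕ (gcd (toℕ i) N)) ≡ true
    gcd-closed i ρi with Bézout.identity (gcd-GCD (toℕ i) N)
    ... | Bézout.+- x y d+yN≡xi =
      subst (λ j → ρ j ≡ true) (ofℕ-cong-% {k = x * toℕ i} {l = gcd (toℕ i) N} xi≡d) (multiple-closed i ρi x)
      where
      xi≡d : x * toℕ i % N ≡ gcd (toℕ i) N % N
      xi≡d = trans (cong (_% N) (sym d+yN≡xi)) (%-remove-+ʳ (gcd (toℕ i) N) (divides y refl))
    ... | Bézout.-+ x y d+xi≡yN = subst (λ j → ρ j ≡ true) (negMod-ofℕ (gcd (toℕ i) N) (x * toℕ i) d+xi≡0)
                                        (ρ-inverse _ (multiple-closed i ρi x))
      where
      d+xi≡0 : (gcd (toℕ i) N + x * toℕ i) % N ≡ 0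
      d+xi≡0 = trans (cong (_% N) d+xi≡yN) (m*n%n≡0 y N)

    divisor-closed : ∀ {g} → g < N → ρ (ofℕ g) ≡ true → ∀ j → g ∣ toℕ j → ρ j ≡ true
    divisor-closed {g} g<N ρg j (divides t j≡tg) = subst (λ j → ρ j ≡ true) ofℕ[tg]≡j (multiple-closed (ofℕ g) ρg t)
      where
      ofℕ[tg]≡j : ofℕ (t * toℕ (ofℕ g)) ≡ j
      ofℕ[tg]≡j = Fin.toℕ-injective (trans (toℕ-ofℕ (t * toℕ (ofℕ g)))
        (trans (cong (λ z → t * z % N) (toℕ-ofℕ-< g<N)) (trans (cong (_% N) (sym j≡tg)) (toℕ%N j))))

    reflections-coset : ∀ g .{{_ : NonZero g}} → g ∣ N → (∀ i → ρ i ≡ residue g 0 i) →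
                        ∀ {j₀} → σ j₀ ≡ true → ∀ j → σ j ≡ residue g (toℕ j₀ % g) j
    reflections-coset g g∣N ρ≗ {j₀} σj₀ j = trans σj≡ρ[j-j₀] (trans (ρ≗ (j ⊖ j₀)) j-j₀∈⟨rᵍ⟩)
      where
      open Residues g g∣N using (⊖-%≡0⁺; ⊖-%≡0⁻)
      σj≡ρ[j-j₀] : σ j ≡ ρ (j ⊖ j₀)
      σj≡ρ[j-j₀] = bool-ext (λ σj → σσ-closed j j₀ σj σj₀)
        (λ ρ[j-j₀] → subst (λ x → σ x ≡ true) (⊖-⊕-cancel j j₀) (ρσ-closed (j ⊖ j₀) j₀ ρ[j-j₀] σj₀))
      j-j₀∈⟨rᵍ⟩ : residue g 0 (j ⊖ j₀) ≡ residue g (toℕ j₀ % g) j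
      j-j₀∈⟨rᵍ⟩ = bool-ext (λ e → ≡⇒≡ᵇ≡true (⊖-%≡0⁻ j j₀ (≡ᵇ≡true⇒≡ e)))
                            (λ e → ≡⇒≡ᵇ≡true (⊖-%≡0⁺ j j₀ (≡ᵇ≡true⇒≡ e)))

meetNontrivially-sym : ∀ {n} (H K : Sub n) → meetNontrivially H K ≡ meetNontrivially K H
meetNontrivially-sym {n} H K =
  any-cong (elems n) λ x → cong (not (isId x) ∧_) (Bool.∧-comm (mem x H) (mem x K))

isNontrivial⁺ : ∀ {n} (H : Sub n) x → not (isId x) ≡ true → mem x H ≡ true → isNontrivial H ≡ true
isNontrivial⁺ {n} H x x≢1 x∈H =
  any-≡true⁺ (λ y → not (isId y) ∧ mem y H) (elems-complete n x) (∧-≡true⁺ x≢1 x∈H)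

isProper⁺ : ∀ {n} (H : Sub n) x → mem x H ≡ false → isProper H ≡ true
isProper⁺ {n} H x x∉H = any-≡true⁺ (λ y → not (mem y H)) (elems-complete n x) (cong not x∉H)

-- Distances in graphs of diameter at most 3

sumPairs-sumBy : ∀ m (d : Fin m → Fin m → ℕ) →
  sumPairs m d ≡ sumBy (λ i → sumBy (λ j → ind (toℕ i <ᵇ toℕ j) * d i j) (allFin m)) (allFin m)
sumPairs-sumBy m d =
  trans (sum-concatMap _ (allFin m))
        (sumBy-cong (allFin m) λ i _ →
           trans (sum-map (d i) (filterᵇ (λ j → toℕ i <ᵇ toℕ j) (allFin m)))
                 (sumBy-filterᵇ (d i) (λ j → toℕ i <ᵇ toℕ j) (allFin m)))

sumPairs-double : ∀ m (d : Fin m → Fin m → ℕ) → (∀ i j → d i j ≡ d j i) → (∀ i → d i i ≡ 0) →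
                  2 * sumPairs m d ≡ sumBy (λ i → sumBy (d i) (allFin m)) (allFin m)
sumPairs-double m d d-sym d-diag = sym (begin
  sumBy (λ i → sumBy (d i) F) F                                  ≡⟨ sumBy-cong F (λ i _ → sumBy-cong F (λ j _ → split i j)) ⟩
  sumBy (λ i → sumBy (λ j → upper i j + lower i j) F) F          ≡⟨ sumBy-cong F (λ i _ → sumBy-+ (upper i) (lower i) F) ⟩
  sumBy (λ i → sumBy (upper i) F + sumBy (lower i) F) F          ≡⟨ sumBy-+ _ _ F ⟩
  sumBy (λ i → sumBy (upper i) F) F + sumBy (λ i → sumBy (lower i) F) F
                                                                 ≡⟨ cong (sumBy (λ i → sumBy (upper i) F) F +_) (sumBy-swap lower F F) ⟩
  sumBy (λ i → sumBy (upper i) F) F + sumBy (λ i → sumBy (upper i) F) F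
      ≡⟨ cong₂ _+_ (sumPairs-sumBy m d) (trans (+-identityʳ (sumPairs m d)) (sumPairs-sumBy m d)) ⟨
  2 * sumPairs m d                                               ∎)
  where
  open ≡-Reasoning
  F = allFin m
  upper lower : Fin m → Fin m → ℕ
  upper i j = ind (toℕ i <ᵇ toℕ j) * d i j
  lower i j = ind (toℕ j <ᵇ toℕ i) * d j i
  split : ∀ i j → d i j ≡ upper i j + lower i j
  split i j with <-cmp (toℕ i) (toℕ j)
  ... | tri< i<j _ _ rewrite <ᵇ≡true i<j | <ᵇ≡false {toℕ j} {toℕ i} (<⇒≤ i<j) =
    trans (sym (+-identityʳ _)) (sym (+-identityʳ _))
  ... | tri> _ _ j<i rewrite <ᵇ≡true j<i | <ᵇ≡false {toℕ i} {toℕ j} (<⇒≤ j<i) =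
    trans (d-sym i j) (sym (+-identityʳ _))
  ... | tri≈ _ i≡j _ rewrite Fin.toℕ-injective i≡j | <ᵇ≡false {toℕ j} {toℕ j} ≤-refl = d-diag j

module _ {A : Set} (V : List A) (meet : A → A → Bool) where

  GraphOn : Graph
  GraphOn = record { size = length V ; Adj = λ i j → i ≢ j × T (meet (List.lookup V i) (List.lookup V j)) }

  private
    m : ℕ
    m = length V

    vertex : Fin m → A
    vertex = List.lookup V

    index-of : ∀ {z} → z ∈ V → ∃[ k ] vertex k ≡ z
    index-of z∈V = Any.index z∈V , sym (lookup-index z∈V)

  commonNeighbour : A → A → Bool
  commonNeighbour x y = any (λ z → meet x z ∧ meet z y) V

  -- The distance between distinct vertices when the diameter is at most 3.
  dist≤3 : A → A → ℕ
  dist≤3 x y = if meet x y then 1 else if commonNeighbour x y then 2 else 3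

  distance : Fin m → Fin m → ℕ
  distance u v = if does (u Fin.≟ v) then 0 else dist≤3 (vertex u) (vertex v)

  dist≤3≤3 : ∀ x y → dist≤3 x y ≤ 3
  dist≤3≤3 x y with meet x y | commonNeighbour x y
  ... | true  | _     = s≤s z≤n
  ... | false | true  = s≤s (s≤s z≤n)
  ... | false | false = ≤-refl

  distance-diag : ∀ u → distance u u ≡ 0
  distance-diag u with u Fin.≟ u
  ... | yes _   = refl
  ... | no  u≢u = contradiction refl u≢u

  common-neighbour⁺ : ∀ {x y} w → meet x (vertex w) ≡ true → meet (vertex w) y ≡ true → commonNeighbour x y ≡ true
  common-neighbour⁺ {x} {y} w xw yw = any-≡true⁺ (λ z → meet x z ∧ meet z y) (∈-lookup {xs = V} w) (∧-≡true⁺ xw yw)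

  short-walk⇒≡ : ∀ {u v l} → Walk GraphOn u v l → l < dist≤3 (vertex u) (vertex v) → u ≡ v
  short-walk⇒≡ here _ = refl
  short-walk⇒≡ {u} {v} (step (_ , uv) here) l<d
    with meet (vertex u) (vertex v) | uv
  ... | true | _ = contradiction l<d (<-irrefl refl)
  short-walk⇒≡ {u} {v} (step {v = w} (_ , uw) (step (_ , wv) here)) l<d
    with meet (vertex u) (vertex v) | commonNeighbour (vertex u) (vertex v) in cn
       | common-neighbour⁺ {vertex u} {vertex v} w (T⇒≡true uw) (T⇒≡true wv)
  ... | true  | _    | _ = contradiction l<d (≤⇒≯ (s≤s z≤n))
  ... | false | true | _ = contradiction l<d (<-irrefl refl)
  short-walk⇒≡ {u} {v} (step _ (step _ (step {k = l} _ _))) l<d =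
    contradiction (≤-trans l<d (dist≤3≤3 (vertex u) (vertex v))) (≤⇒≯ (s≤s (s≤s (s≤s z≤n))))

  dist≤3-self : ∀ x → meet x x ≡ true → dist≤3 x x ≡ 1
  dist≤3-self x xx rewrite xx = refl

  module _ (meet-sym : ∀ x y → meet x y ≡ meet y x) where

    commonNeighbour-sym : ∀ x y → commonNeighbour x y ≡ commonNeighbour y x
    commonNeighbour-sym x y = any-cong V λ z →
      trans (Bool.∧-comm (meet x z) (meet z y)) (cong₂ _∧_ (meet-sym z y) (meet-sym x z))

    dist≤3-sym : ∀ x y → dist≤3 x y ≡ dist≤3 y x
    dist≤3-sym x y rewrite meet-sym x y | commonNeighbour-sym x y = refl

    distance-sym : ∀ u v → distance u v ≡ distance v u
    distance-sym u v with u Fin.≟ v | v Fin.≟ u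
    ... | yes _    | yes _    = refl
    ... | no  _    | no  _    = dist≤3-sym (vertex u) (vertex v)
    ... | yes refl | no  u≢u  = contradiction refl u≢u
    ... | no  u≢u  | yes refl = contradiction refl u≢u

    distance-isDistance : (Hub : A → Set) →
      (∀ x → x ∈ V → ∃[ h ] h ∈ V × Hub h × meet x h ≡ true) →
      (∀ {h h′} → Hub h → Hub h′ → meet h h′ ≡ true) →
      ∀ u v → IsDistance GraphOn u v (distance u v)
    distance-isDistance Hub hub hubs-meet u v with u Fin.≟ v
    ... | yes refl = here , λ _ ()
    ... | no  u≢v  = shortest-walk , λ l l<d walk → u≢v (short-walk⇒≡ walk l<d)
      where
      x = vertex u
      y = vertex v
      shortest-walk : Walk GraphOn u v (dist≤3 x y)
      shortest-walk with meet x y in xy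
      ... | true  = step (u≢v , ≡true⇒T xy) here
      ... | false with commonNeighbour x y in cn
      ...   | true with any-≡true⁻ (λ z → meet x z ∧ meet z y) V cn
      ...     | z , z∈V , xzy with index-of z∈V | ∧-≡true⁻ {meet x z} xzy
      ...       | w , refl | xw , wy =
        step (u≢w , ≡true⇒T xw) (step (w≢v , ≡true⇒T wy) here)
        where
        u≢w : u ≢ w
        u≢w refl = contradiction (trans (sym wy) xy) λ ()
        w≢v : w ≢ v
        w≢v refl = contradiction (trans (sym xw) xy) λ ()
      shortest-walk | false | false with hub x (∈-lookup u) | hub y (∈-lookup v)
      ... | h , h∈V , hub-h , xh | h′ , h′∈V , hub-h′ , yh′ with index-of h∈V | index-of h′∈V
      ...   | w , refl | w′ , refl =
        step (u≢w , ≡true⇒T xh) (step (w≢w′ , ≡true⇒T hh′) (step (w′≢v , ≡true⇒T h′y) here))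
        where
        hh′ = hubs-meet hub-h hub-h′
        h′y = trans (meet-sym (vertex w′) y) yh′
        no-common : ∀ {t} → commonNeighbour x y ≡ true → t
        no-common cn′ = contradiction (trans (sym cn′) cn) λ ()
        u≢w : u ≢ w
        u≢w refl = no-common (common-neighbour⁺ w′ hh′ h′y)
        w≢w′ : w ≢ w′
        w≢w′ refl = no-common (common-neighbour⁺ w xh h′y)
        w′≢v : w′ ≢ v
        w′≢v refl = no-common (common-neighbour⁺ w xh hh′)

    -- dist≤3 x x = 1 rather than 0, hence the summand m.
    wiener-double : (∀ x → x ∈ V → meet x x ≡ true) →
                    2 * sumPairs m distance + m ≡ sumBy (λ x → sumBy (dist≤3 x) V) V
    wiener-double self-meet = begin
      2 * sumPairs m distance + m
        ≡⟨ cong₂ _+_ (sumPairs-double m distance distance-sym distance-diag) (sym m≡sum1) ⟩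
      sumBy (λ u → sumBy (distance u) F) F + sumBy (λ _ → 1) F   ≡⟨ sumBy-+ _ _ F ⟨
      sumBy (λ u → sumBy (distance u) F + 1) F                   ≡⟨ sumBy-cong F (λ u _ → row u) ⟨
      sumBy (λ u → sumBy (λ v → dist≤3 (vertex u) (vertex v)) F) F
        ≡⟨ sumBy-cong F (λ u _ → sumBy-lookup V (dist≤3 (vertex u))) ⟩
      sumBy (λ u → sumBy (dist≤3 (vertex u)) V) F                ≡⟨ sumBy-lookup V (λ x → sumBy (dist≤3 x) V) ⟩
      sumBy (λ x → sumBy (dist≤3 x) V) V                         ∎
      where
      open ≡-Reasoning
      F = allFin m
      m≡sum1 : sumBy (λ _ → 1) F ≡ m
      m≡sum1 = trans (sumBy-const 1 F) (trans (*-identityʳ _) (length-tabulate id))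
      split : ∀ u v → dist≤3 (vertex u) (vertex v) ≡ distance u v + δ Fin._≟_ v u
      split u v with u Fin.≟ v | v Fin.≟ u
      ... | yes refl | yes _   = dist≤3-self (vertex u) (self-meet (vertex u) (∈-lookup u))
      ... | no  _    | no  _   = sym (+-identityʳ _)
      ... | yes refl | no u≢u  = contradiction refl u≢u
      ... | no u≢u   | yes refl = contradiction refl u≢u
      row : ∀ u → sumBy (λ v → dist≤3 (vertex u) (vertex v)) F ≡ sumBy (distance u) F + 1
      row u = trans (sumBy-cong F (λ v _ → split u v))
                    (trans (sumBy-+ (distance u) (λ v → δ Fin._≟_ v u) F) (cong (sumBy (distance u) F +_) (count-allFin u)))

-- The proper non-trivial subgroups of D_{2p²}

-- A sum type, so that decidable equality comes from the library; the indices
-- k < p² and c < p are imposed by Valid.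
Code : Set
Code = ⊤ ⊎ ⊤ ⊎ ℕ ⊎ ℕ

pattern ⟨r⟩          = inj₁ tt
pattern ⟨rᵖ⟩         = inj₂ (inj₁ tt)
pattern ⟨rᵏs⟩ k      = inj₂ (inj₂ (inj₁ k))
pattern ⟨rᵖ,rᶜs⟩ c   = inj₂ (inj₂ (inj₂ c))

_≟ᶜ_ : DecidableEquality Code
_≟ᶜ_ = Sum.≡-dec Unit._≟_ (Sum.≡-dec Unit._≟_ (Sum.≡-dec _≟_ _≟_))

module Dihedral (q : ℕ) where

  -- p = 2 + q makes p and p² = p * (p * 1) successors by computation, as
  -- Fin arithmetic and the NonZero instances require.
  p : ℕ
  p = 2 + q

  n : ℕ
  n = p ^ 2

  n≡p*p : n ≡ p * p
  n≡p*p = cong (p *_) (*-identityʳ p)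

  1<p : 1 < p
  1<p = s≤s (s≤s z≤n)

  p<n : p < n
  p<n = subst (p <_) (sym n≡p*p) (m<m*n p p 1<p)

  p∣n : p ∣ n
  p∣n = divides p (trans n≡p*p (*-comm p p))

  1∣n : 1 ∣ n
  1∣n = divides n (sym (*-identityʳ n))

  Valid : Code → Set
  Valid ⟨r⟩           = ⊤
  Valid ⟨rᵖ⟩          = ⊤
  Valid (⟨rᵏs⟩ k)     = k < n
  Valid (⟨rᵖ,rᶜs⟩ c)  = c < p

  codes : List Code
  codes = ⟨r⟩ ∷ ⟨rᵖ⟩ ∷ map ⟨rᵏs⟩ (downFrom n) ++ map ⟨rᵖ,rᶜs⟩ (downFrom p)

  -- ⟨rᵍ, rᶜs⟩ (g ∣ p²) consists of the rⁱ with g ∣ i and the rⁱs with i ≡ c mod g;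
  -- ⟨rᵏs⟩ is the case g = p².
  rotations reflections : Code → Fin n → Bool
  rotations ⟨r⟩            = residue 1 0
  rotations ⟨rᵖ⟩           = residue p 0
  rotations (⟨rᵏs⟩ _)      = residue n 0
  rotations (⟨rᵖ,rᶜs⟩ _)   = residue p 0
  reflections ⟨r⟩          = λ _ → false
  reflections ⟨rᵖ⟩         = λ _ → false
  reflections (⟨rᵏs⟩ k)    = residue n k
  reflections (⟨rᵖ,rᶜs⟩ c) = residue p c

  subgroup : Code → Sub n
  subgroup c = tabulate (rotations c) , tabulate (reflections c)

  mem-rotation : ∀ c i → mem (i , false) (subgroup c) ≡ rotations c i
  mem-rotation c i = Vec.lookup∘tabulate (rotations c) i

  mem-reflection : ∀ c i → mem (i , true) (subgroup c) ≡ reflections c i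
  mem-reflection c i = Vec.lookup∘tabulate (reflections c) i

  subgroup-laws : ∀ c → SubgroupLaws (rotations c) (reflections c)
  subgroup-laws ⟨r⟩          = cyclic-laws 1 1∣n
  subgroup-laws ⟨rᵖ⟩         = cyclic-laws p p∣n
  subgroup-laws (⟨rᵏs⟩ k)    = coset-laws n ∣-refl k
  subgroup-laws (⟨rᵖ,rᶜs⟩ c) = coset-laws p p∣n c

  isVertex : Sub n → Bool
  isVertex H = isSubgroup H ∧ isNontrivial H ∧ isProper H

  r¹ rᵖ : Fin n
  r¹ = ofℕ 1
  rᵖ = ofℕ p

  toℕ-r¹ : toℕ r¹ ≡ 1
  toℕ-r¹ = toℕ-ofℕ-< (<-trans 1<p p<n)

  toℕ-rᵖ : toℕ rᵖ ≡ p
  toℕ-rᵖ = toℕ-ofℕ-< p<n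

  hasReflection : Code → ℕ → Bool
  hasReflection ⟨r⟩            _ = false
  hasReflection ⟨rᵖ⟩           _ = false
  hasReflection (⟨rᵏs⟩ k′)     k = k′ ≡ᵇ k
  hasReflection (⟨rᵖ,rᶜs⟩ c)   k = k % p ≡ᵇ c

  mem-ofℕ-reflection : ∀ c {k} → k < n → mem (ofℕ k , true) (subgroup c) ≡ hasReflection c k
  mem-ofℕ-reflection c {k} k<n = trans (mem-reflection c (ofℕ k)) (reflections-ofℕ c)
    where
    reflections-ofℕ : ∀ c → reflections c (ofℕ k) ≡ hasReflection c k
    reflections-ofℕ ⟨r⟩           = refl
    reflections-ofℕ ⟨rᵖ⟩          = refl
    reflections-ofℕ (⟨rᵏs⟩ k′)    =
      trans (cong (λ x → x % n ≡ᵇ k′) (toℕ-ofℕ-< k<n)) (trans (cong (_≡ᵇ k′) (m<n⇒m%n≡m k<n)) (≡ᵇ-comm k k′))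
    reflections-ofℕ (⟨rᵖ,rᶜs⟩ c) = cong (λ x → x % p ≡ᵇ c) (toℕ-ofℕ-< k<n)

  containsRᵖ : Code → Bool
  containsRᵖ (⟨rᵏs⟩ _) = false
  containsRᵖ _         = true

  mem-r¹ : ∀ c → mem (r¹ , false) (subgroup c) ≡ does (c ≟ᶜ ⟨r⟩)
  mem-r¹ c = trans (mem-rotation c r¹) (rotations-r¹ c)
    where
    rotations-r¹ : ∀ c → rotations c r¹ ≡ does (c ≟ᶜ ⟨r⟩)
    rotations-r¹ ⟨r⟩          = refl
    rotations-r¹ ⟨rᵖ⟩         = refl
    rotations-r¹ (⟨rᵏs⟩ _)    = refl
    rotations-r¹ (⟨rᵖ,rᶜs⟩ _) = refl

  mem-rᵖ : ∀ c → mem (rᵖ , false) (subgroup c) ≡ containsRᵖ c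
  mem-rᵖ c = trans (mem-rotation c rᵖ) (rotations-rᵖ c)
    where
    rotations-rᵖ : ∀ c → rotations c rᵖ ≡ containsRᵖ c
    rotations-rᵖ ⟨r⟩          = cong (_≡ᵇ 0) (n%1≡0 (toℕ rᵖ))
    rotations-rᵖ ⟨rᵖ⟩         = trans (cong (λ x → x % p ≡ᵇ 0) toℕ-rᵖ) (cong (_≡ᵇ 0) (n%n≡0 p))
    rotations-rᵖ (⟨rᵏs⟩ _)    = trans (cong (λ x → x % n ≡ᵇ 0) toℕ-rᵖ) (cong (_≡ᵇ 0) (m<n⇒m%n≡m p<n))
    rotations-rᵖ (⟨rᵖ,rᶜs⟩ _) = trans (cong (λ x → x % p ≡ᵇ 0) toℕ-rᵖ) (cong (_≡ᵇ 0) (n%n≡0 p))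

  subgroup-isVertex : ∀ c → Valid c → isVertex (subgroup c) ≡ true
  subgroup-isVertex c valid = ∧-≡true⁺ is-subgroup (∧-≡true⁺ (nontrivial c valid) (proper c))
    where
    is-subgroup : isSubgroup (subgroup c) ≡ true
    is-subgroup = isSubgroup⁺ {R = tabulate (rotations c)} {S = tabulate (reflections c)}
      (SubgroupLaws-≗ (sym ∘ mem-rotation c) (sym ∘ mem-reflection c) (subgroup-laws c))
    rᵖ≢1 : not (isId (rᵖ , false)) ≡ true
    rᵖ≢1 = cong (λ x → not (x ≡ᵇ 0)) toℕ-rᵖ
    nontrivial : ∀ c → Valid c → isNontrivial (subgroup c) ≡ true
    nontrivial ⟨r⟩          _   = isNontrivial⁺ (subgroup ⟨r⟩) (rᵖ , false) rᵖ≢1 (mem-rᵖ ⟨r⟩)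
    nontrivial ⟨rᵖ⟩         _   = isNontrivial⁺ (subgroup ⟨rᵖ⟩) (rᵖ , false) rᵖ≢1 (mem-rᵖ ⟨rᵖ⟩)
    nontrivial (⟨rᵖ,rᶜs⟩ c) _   = isNontrivial⁺ (subgroup (⟨rᵖ,rᶜs⟩ c)) (rᵖ , false) rᵖ≢1 (mem-rᵖ (⟨rᵖ,rᶜs⟩ c))
    nontrivial (⟨rᵏs⟩ k)    k<n =
      isNontrivial⁺ (subgroup (⟨rᵏs⟩ k)) (ofℕ k , true) refl (trans (mem-ofℕ-reflection (⟨rᵏs⟩ k) k<n) (≡ᵇ-refl k))
    proper : ∀ c → isProper (subgroup c) ≡ true
    proper ⟨r⟩          = isProper⁺ (subgroup ⟨r⟩) (fzero , true) refl
    proper ⟨rᵖ⟩         = isProper⁺ (subgroup ⟨rᵖ⟩) (r¹ , false) (mem-r¹ ⟨rᵖ⟩)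
    proper (⟨rᵏs⟩ k)    = isProper⁺ (subgroup (⟨rᵏs⟩ k)) (r¹ , false) (mem-r¹ (⟨rᵏs⟩ k))
    proper (⟨rᵖ,rᶜs⟩ c) = isProper⁺ (subgroup (⟨rᵖ,rᶜs⟩ c)) (r¹ , false) (mem-r¹ (⟨rᵖ,rᶜs⟩ c))

  codes-separated : ∀ a b → Valid a → Valid b →
    does (a ≟ᶜ ⟨r⟩) ≡ does (b ≟ᶜ ⟨r⟩) → containsRᵖ a ≡ containsRᵖ b →
    (∀ {k} → k < n → hasReflection a k ≡ hasReflection b k) → a ≡ b
  codes-separated ⟨r⟩ ⟨r⟩ _ _ _ _ _ = refl
  codes-separated ⟨r⟩ ⟨rᵖ⟩ _ _ () _ _
  codes-separated ⟨r⟩ (⟨rᵏs⟩ _) _ _ () _ _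
  codes-separated ⟨r⟩ (⟨rᵖ,rᶜs⟩ _) _ _ () _ _
  codes-separated ⟨rᵖ⟩ ⟨r⟩ _ _ () _ _
  codes-separated ⟨rᵖ⟩ ⟨rᵖ⟩ _ _ _ _ _ = refl
  codes-separated ⟨rᵖ⟩ (⟨rᵏs⟩ _) _ _ _ () _
  codes-separated ⟨rᵖ⟩ (⟨rᵖ,rᶜs⟩ c) _ c<p _ _ same =
    contradiction (trans (same (<-trans c<p p<n)) (≡⇒≡ᵇ≡true (m<n⇒m%n≡m c<p))) λ ()
  codes-separated (⟨rᵏs⟩ _) ⟨r⟩ _ _ () _ _
  codes-separated (⟨rᵏs⟩ _) ⟨rᵖ⟩ _ _ _ () _
  codes-separated (⟨rᵏs⟩ k) (⟨rᵏs⟩ k′) k<n _ _ _ same =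
    cong ⟨rᵏs⟩ (sym (≡ᵇ≡true⇒≡ (trans (sym (same k<n)) (≡ᵇ-refl k))))
  codes-separated (⟨rᵏs⟩ _) (⟨rᵖ,rᶜs⟩ _) _ _ _ () _
  codes-separated (⟨rᵖ,rᶜs⟩ _) ⟨r⟩ _ _ () _ _
  codes-separated (⟨rᵖ,rᶜs⟩ c) ⟨rᵖ⟩ c<p _ _ _ same =
    contradiction (trans (sym (same (<-trans c<p p<n))) (≡⇒≡ᵇ≡true (m<n⇒m%n≡m c<p))) λ ()
  codes-separated (⟨rᵖ,rᶜs⟩ _) (⟨rᵏs⟩ _) _ _ _ () _
  codes-separated (⟨rᵖ,rᶜs⟩ c) (⟨rᵖ,rᶜs⟩ c′) c<p _ _ _ same =
    cong ⟨rᵖ,rᶜs⟩ (trans (sym (m<n⇒m%n≡m c<p))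
      (≡ᵇ≡true⇒≡ (trans (sym (same (<-trans c<p p<n))) (≡⇒≡ᵇ≡true (m<n⇒m%n≡m c<p)))))

  subgroup-injective : ∀ {a b} → Valid a → Valid b → subgroup a ≡ subgroup b → a ≡ b
  subgroup-injective {a} {b} va vb a≡b = codes-separated a b va vb
    (trans (sym (mem-r¹ a)) (trans (cong (mem (r¹ , false)) a≡b) (mem-r¹ b)))
    (trans (sym (mem-rᵖ a)) (trans (cong (mem (rᵖ , false)) a≡b) (mem-rᵖ b)))
    (λ {k} k<n → trans (sym (mem-ofℕ-reflection a k<n))
                       (trans (cong (mem (ofℕ k , true)) a≡b) (mem-ofℕ-reflection b k<n)))

  meet-⟨rᵏs⟩ : ∀ {k} → k < n → ∀ H → meetNontrivially (subgroup (⟨rᵏs⟩ k)) H ≡ mem (ofℕ k , true) H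
  meet-⟨rᵏs⟩ {k} k<n H = bool-ext common⇒rᵏs rᵏs⇒common
    where
    f : D n → Bool
    f x = not (isId x) ∧ mem x (subgroup (⟨rᵏs⟩ k)) ∧ mem x H
    rᵏs∈ : mem (ofℕ k , true) (subgroup (⟨rᵏs⟩ k)) ≡ true
    rᵏs∈ = trans (mem-ofℕ-reflection (⟨rᵏs⟩ k) k<n) (≡ᵇ-refl k)
    rᵏs⇒common : mem (ofℕ k , true) H ≡ true → any f (elems n) ≡ true
    rᵏs⇒common k∈H = any-≡true⁺ f (elems-complete n (ofℕ k , true)) (∧-≡true⁺ rᵏs∈ k∈H)
    only-rᵏs : ∀ x → f x ≡ true → x ≡ (ofℕ k , true)
    only-rᵏs (i , false) fx with ∧-≡true⁻ {not (isId (i , false))} fx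
    ... | i≢1 , i∈ with ∧-≡true⁻ {mem (i , false) (subgroup (⟨rᵏs⟩ k))} i∈
    ...   | i∈⟨rᵏs⟩ , _ = contradiction (trans (sym i≢1) (cong (λ x → not (x ≡ᵇ 0)) i≡0)) λ ()
      where
      i≡0 : toℕ i ≡ 0
      i≡0 = trans (sym (toℕ%N i)) (≡ᵇ≡true⇒≡ (trans (sym (mem-rotation (⟨rᵏs⟩ k) i)) i∈⟨rᵏs⟩))
    only-rᵏs (j , true) fx with ∧-≡true⁻ (proj₂ (∧-≡true⁻ {true} fx))
    ... | j∈⟨rᵏs⟩ , _ = cong (_, true) (Fin.toℕ-injective (trans (sym (toℕ%N j))
          (trans (≡ᵇ≡true⇒≡ (trans (sym (mem-reflection (⟨rᵏs⟩ k) j)) j∈⟨rᵏs⟩)) (sym (toℕ-ofℕ-< k<n)))))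
    common⇒rᵏs : any f (elems n) ≡ true → mem (ofℕ k , true) H ≡ true
    common⇒rᵏs common with any-≡true⁻ f (elems n) common
    ... | x , _ , fx with only-rᵏs x fx
    ...   | refl = proj₂ (∧-≡true⁻ (proj₂ (∧-≡true⁻ {true} fx)))

  meet-via-rᵖ : ∀ a b → containsRᵖ a ≡ true → containsRᵖ b ≡ true → meetNontrivially (subgroup a) (subgroup b) ≡ true
  meet-via-rᵖ a b a∋rᵖ b∋rᵖ = any-≡true⁺ (λ x → not (isId x) ∧ mem x (subgroup a) ∧ mem x (subgroup b))
    (elems-complete n (rᵖ , false))
    (∧-≡true⁺ (cong (λ x → not (x ≡ᵇ 0)) toℕ-rᵖ) (∧-≡true⁺ (trans (mem-rᵖ a) a∋rᵖ) (trans (mem-rᵖ b) b∋rᵖ)))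

  meetCode : Code → Code → Bool
  meetCode (⟨rᵏs⟩ k) b = hasReflection b k
  meetCode a (⟨rᵏs⟩ k) = hasReflection a k
  meetCode _ _         = true

  meet-subgroup : ∀ a b → Valid a → Valid b → meetNontrivially (subgroup a) (subgroup b) ≡ meetCode a b
  meet-subgroup (⟨rᵏs⟩ k) b k<n _ = trans (meet-⟨rᵏs⟩ k<n (subgroup b)) (mem-ofℕ-reflection b k<n)
  meet-subgroup ⟨r⟩ (⟨rᵏs⟩ k) _ k<n =
    trans (meetNontrivially-sym (subgroup ⟨r⟩) (subgroup (⟨rᵏs⟩ k))) (meet-subgroup (⟨rᵏs⟩ k) ⟨r⟩ k<n tt)
  meet-subgroup ⟨rᵖ⟩ (⟨rᵏs⟩ k) _ k<n =
    trans (meetNontrivially-sym (subgroup ⟨rᵖ⟩) (subgroup (⟨rᵏs⟩ k))) (meet-subgroup (⟨rᵏs⟩ k) ⟨rᵖ⟩ k<n tt)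
  meet-subgroup (⟨rᵖ,rᶜs⟩ c) (⟨rᵏs⟩ k) c<p k<n =
    trans (meetNontrivially-sym (subgroup (⟨rᵖ,rᶜs⟩ c)) (subgroup (⟨rᵏs⟩ k)))
          (meet-subgroup (⟨rᵏs⟩ k) (⟨rᵖ,rᶜs⟩ c) k<n c<p)
  meet-subgroup ⟨r⟩          ⟨r⟩          _ _ = meet-via-rᵖ ⟨r⟩ ⟨r⟩ refl refl
  meet-subgroup ⟨r⟩          ⟨rᵖ⟩         _ _ = meet-via-rᵖ ⟨r⟩ ⟨rᵖ⟩ refl refl
  meet-subgroup ⟨r⟩          (⟨rᵖ,rᶜs⟩ c) _ _ = meet-via-rᵖ ⟨r⟩ (⟨rᵖ,rᶜs⟩ c) refl refl
  meet-subgroup ⟨rᵖ⟩         ⟨r⟩          _ _ = meet-via-rᵖ ⟨rᵖ⟩ ⟨r⟩ refl refl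
  meet-subgroup ⟨rᵖ⟩         ⟨rᵖ⟩         _ _ = meet-via-rᵖ ⟨rᵖ⟩ ⟨rᵖ⟩ refl refl
  meet-subgroup ⟨rᵖ⟩         (⟨rᵖ,rᶜs⟩ c) _ _ = meet-via-rᵖ ⟨rᵖ⟩ (⟨rᵖ,rᶜs⟩ c) refl refl
  meet-subgroup (⟨rᵖ,rᶜs⟩ c) ⟨r⟩          _ _ = meet-via-rᵖ (⟨rᵖ,rᶜs⟩ c) ⟨r⟩ refl refl
  meet-subgroup (⟨rᵖ,rᶜs⟩ c) ⟨rᵖ⟩         _ _ = meet-via-rᵖ (⟨rᵖ,rᶜs⟩ c) ⟨rᵖ⟩ refl refl
  meet-subgroup (⟨rᵖ,rᶜs⟩ c) (⟨rᵖ,rᶜs⟩ d) _ _ = meet-via-rᵖ (⟨rᵖ,rᶜs⟩ c) (⟨rᵖ,rᶜs⟩ d) refl refl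

  hub : Code → ℕ
  hub (⟨rᵏs⟩ k) = k % p
  hub _         = 0

  hub<p : ∀ a → hub a < p
  hub<p ⟨r⟩          = s≤s z≤n
  hub<p ⟨rᵖ⟩         = s≤s z≤n
  hub<p (⟨rᵏs⟩ k)    = m%n<n k p
  hub<p (⟨rᵖ,rᶜs⟩ _) = s≤s z≤n

  meetCode-hub : ∀ a → meetCode a (⟨rᵖ,rᶜs⟩ (hub a)) ≡ true
  meetCode-hub ⟨r⟩          = refl
  meetCode-hub ⟨rᵖ⟩         = refl
  meetCode-hub (⟨rᵏs⟩ k)    = ≡ᵇ-refl (k % p)
  meetCode-hub (⟨rᵖ,rᶜs⟩ _) = refl

  V : List (Sub n)
  V = vertices n

  sumBy-codes : (f : Code → ℕ) →
    sumBy f codes ≡ f ⟨r⟩ + (f ⟨rᵖ⟩ + (sumBy (f ∘ ⟨rᵏs⟩) (downFrom n) + sumBy (f ∘ ⟨rᵖ,rᶜs⟩) (downFrom p)))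
  sumBy-codes f = cong (λ x → f ⟨r⟩ + (f ⟨rᵖ⟩ + x))
    (trans (sumBy-++ f (map ⟨rᵏs⟩ (downFrom n)) (map ⟨rᵖ,rᶜs⟩ (downFrom p)))
           (cong₂ _+_ (sumBy-map f ⟨rᵏs⟩ (downFrom n)) (sumBy-map f ⟨rᵖ,rᶜs⟩ (downFrom p))))

  codes-valid : ∀ {c} → c ∈ codes → Valid c
  codes-valid (here refl)         = tt
  codes-valid (there (here refl)) = tt
  codes-valid (there (there c∈)) with ∈-++⁻ (map ⟨rᵏs⟩ (downFrom n)) c∈
  ... | inj₁ c∈⟨rᵏs⟩ with ∈-map⁻ ⟨rᵏs⟩ c∈⟨rᵏs⟩
  ...   | k , k∈ , refl = ∈-downFrom⁻ k∈
  codes-valid (there (there c∈)) | inj₂ c∈⟨rᵖ,rᶜs⟩ with ∈-map⁻ ⟨rᵖ,rᶜs⟩ c∈⟨rᵖ,rᶜs⟩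
  ...   | c , c∈ , refl = ∈-downFrom⁻ c∈

  codes-enumerate : ∀ c → Valid c → sumBy (λ c′ → δ _≟ᶜ_ c′ c) codes ≡ 1
  codes-enumerate c valid = trans (sumBy-codes (λ c′ → δ _≟ᶜ_ c′ c)) (count c valid)
    where
    none : ∀ xs {f : ℕ → ℕ} → (∀ x → f x ≡ 0) → sumBy f xs ≡ 0
    none xs f≡0 = sumBy-zero xs (λ x _ → f≡0 x)
    count : ∀ c → Valid c → δ _≟ᶜ_ ⟨r⟩ c + (δ _≟ᶜ_ ⟨rᵖ⟩ c + (sumBy (λ k → δ _≟ᶜ_ (⟨rᵏs⟩ k) c) (downFrom n)
                                        + sumBy (λ d → δ _≟ᶜ_ (⟨rᵖ,rᶜs⟩ d) c) (downFrom p))) ≡ 1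
    count ⟨r⟩          _   = cong₂ (λ x y → 1 + (x + y)) (none (downFrom n) λ _ → refl) (none (downFrom p) λ _ → refl)
    count ⟨rᵖ⟩         _   = cong₂ (λ x y → 1 + (x + y)) (none (downFrom n) λ _ → refl) (none (downFrom p) λ _ → refl)
    count (⟨rᵏs⟩ k)    k<n = trans (cong₂ _+_ (count-downFrom k<n) (none (downFrom p) λ _ → refl)) refl
    count (⟨rᵖ,rᶜs⟩ c) c<p = cong₂ _+_ (none (downFrom n) λ _ → refl) (count-downFrom c<p)

  subgroup∈V : ∀ c → Valid c → subgroup c ∈ V
  subgroup∈V c valid = ∈-filter⁺ (T? ∘ isVertex) (subsets-complete n (subgroup c)) (≡true⇒T (subgroup-isVertex c valid))

  cnCode : Code → Code → Bool
  cnCode (⟨rᵏs⟩ k) (⟨rᵏs⟩ k′) = k′ % p ≡ᵇ k % p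
  cnCode _         _          = true

  distCode : Code → Code → ℕ
  distCode a b = if meetCode a b then 1 else if cnCode a b then 2 else 3

  row : Code → ℕ
  row a = sumBy (distCode a) codes

  row-⟨r⟩ : row ⟨r⟩ ≡ 2 + (n * 2 + p * 1)
  row-⟨r⟩ = trans (sumBy-codes (distCode ⟨r⟩)) (cong (2 +_) (cong₂ _+_ (sumBy-const-downFrom 2 n) (sumBy-const-downFrom 1 p)))

  row-⟨rᵖ⟩ : row ⟨rᵖ⟩ ≡ 2 + (n * 2 + p * 1)
  row-⟨rᵖ⟩ = trans (sumBy-codes (distCode ⟨rᵖ⟩)) (cong (2 +_) (cong₂ _+_ (sumBy-const-downFrom 2 n) (sumBy-const-downFrom 1 p)))

  p-residues : ∀ {r} → r < p → sumBy (λ k → ind (k % p ≡ᵇ r)) (downFrom n) ≡ p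
  p-residues {r} r<p = trans (cong (λ m → sumBy (λ k → ind (k % p ≡ᵇ r)) (downFrom m)) n≡p*p) (count-residue p r<p p)

  row-⟨rᵖ,rᶜs⟩ : ∀ {c} → c < p → row (⟨rᵖ,rᶜs⟩ c) ≡ 2 + n * 2
  row-⟨rᵖ,rᶜs⟩ {c} c<p = trans (sumBy-codes (distCode (⟨rᵖ,rᶜs⟩ c))) (cong (2 +_) (begin
    sumBy f (downFrom n) + sumBy (λ _ → 1) (downFrom p)
                                ≡⟨ cong (sumBy f (downFrom n) +_) (trans (sumBy-const-downFrom 1 p) (*-identityʳ p)) ⟩
    sumBy f (downFrom n) + p                           ≡⟨ cong (sumBy f (downFrom n) +_) (p-residues c<p) ⟨
    sumBy f (downFrom n) + sumBy χ (downFrom n)        ≡⟨ sumBy-complementary-downFrom f χ n 2 (λ k _ → one-or-two k) ⟩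
    n * 2                                              ∎))
    where
    open ≡-Reasoning
    f χ : ℕ → ℕ
    f k = distCode (⟨rᵖ,rᶜs⟩ c) (⟨rᵏs⟩ k)
    χ k = ind (k % p ≡ᵇ c)
    one-or-two : ∀ k → f k + χ k ≡ 2
    one-or-two k with k % p ≡ᵇ c
    ... | true  = refl
    ... | false = refl

  row-⟨rᵏs⟩ : ∀ {k} → k < n → row (⟨rᵏs⟩ k) + (p + 2) ≡ n * 3 + p * 2 + 4
  row-⟨rᵏs⟩ {k} k<n = begin
    row (⟨rᵏs⟩ k) + (p + 2)                          ≡⟨ cong (_+ (p + 2)) (sumBy-codes (distCode (⟨rᵏs⟩ k))) ⟩
    2 + (2 + (sumBy f (downFrom n) + sumBy g (downFrom p))) + (p + 2)
                                                     ≡⟨ solve-∀-shape (sumBy f (downFrom n)) (sumBy g (downFrom p)) p ⟩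
    (sumBy f (downFrom n) + (1 + p)) + (sumBy g (downFrom p) + 1) + 4
                                                     ≡⟨ cong₂ (λ x y → x + y + 4) f-sum g-sum ⟩
    n * 3 + p * 2 + 4                                ∎
    where
    open ≡-Reasoning
    f g : ℕ → ℕ
    f k′ = distCode (⟨rᵏs⟩ k) (⟨rᵏs⟩ k′)
    g c  = distCode (⟨rᵏs⟩ k) (⟨rᵖ,rᶜs⟩ c)
    solve-∀-shape : ∀ a b p → 2 + (2 + (a + b)) + (p + 2) ≡ (a + (1 + p)) + (b + 1) + 4
    solve-∀-shape = solve-∀
    one-two-or-three : ∀ k′ → f k′ + (ind (k′ ≡ᵇ k) + ind (k′ % p ≡ᵇ k % p)) ≡ 3
    one-two-or-three k′ with k′ ≡ᵇ k in k′≡k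
    ... | true rewrite ≡ᵇ≡true⇒≡ {k′} {k} k′≡k | ≡ᵇ-refl (k % p) = refl
    ... | false with k′ % p ≡ᵇ k % p
    ...   | true  = refl
    ...   | false = refl
    one-or-two : ∀ c → g c + ind (c ≡ᵇ k % p) ≡ 2
    one-or-two c rewrite ≡ᵇ-comm c (k % p) with k % p ≡ᵇ c
    ... | true  = refl
    ... | false = refl
    f-sum : sumBy f (downFrom n) + (1 + p) ≡ n * 3
    f-sum = begin
      sumBy f (downFrom n) + (1 + p)
        ≡⟨ cong (sumBy f (downFrom n) +_) (cong₂ _+_ (count-downFrom k<n) (p-residues (m%n<n k p))) ⟨
      sumBy f (downFrom n) + (sumBy (λ k′ → ind (k′ ≡ᵇ k)) (downFrom n) + sumBy (λ k′ → ind (k′ % p ≡ᵇ k % p)) (downFrom n))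
        ≡⟨ cong (sumBy f (downFrom n) +_) (sumBy-+ (λ k′ → ind (k′ ≡ᵇ k)) (λ k′ → ind (k′ % p ≡ᵇ k % p)) (downFrom n)) ⟨
      sumBy f (downFrom n) + sumBy (λ k′ → ind (k′ ≡ᵇ k) + ind (k′ % p ≡ᵇ k % p)) (downFrom n)
        ≡⟨ sumBy-complementary-downFrom f (λ k′ → ind (k′ ≡ᵇ k) + ind (k′ % p ≡ᵇ k % p)) n 3
             (λ k′ _ → one-two-or-three k′) ⟩
      n * 3 ∎
    g-sum : sumBy g (downFrom p) + 1 ≡ p * 2
    g-sum = trans (cong (sumBy g (downFrom p) +_) (sym (count-downFrom (m%n<n k p))))
                  (sumBy-complementary-downFrom g (λ c → ind (c ≡ᵇ k % p)) p 2 (λ c _ → one-or-two c))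

  sumBy-row-⟨rᵏs⟩ : sumBy (row ∘ ⟨rᵏs⟩) (downFrom n) + n * (p + 2) ≡ n * (n * 3 + p * 2 + 4)
  sumBy-row-⟨rᵏs⟩ =
    trans (cong (sumBy (row ∘ ⟨rᵏs⟩) (downFrom n) +_) (sym (sumBy-const-downFrom (p + 2) n)))
          (sumBy-complementary-downFrom (row ∘ ⟨rᵏs⟩) (λ _ → p + 2) n _ (λ _ → row-⟨rᵏs⟩))

  sumBy-row-⟨rᵖ,rᶜs⟩ : sumBy (row ∘ ⟨rᵖ,rᶜs⟩) (downFrom p) ≡ p * (2 + n * 2)
  sumBy-row-⟨rᵖ,rᶜs⟩ =
    trans (sumBy-cong (downFrom p) (λ c c∈ → row-⟨rᵖ,rᶜs⟩ (∈-downFrom⁻ c∈))) (sumBy-const-downFrom (2 + n * 2) p)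

  sumBy-row : sumBy row codes ≡
    (2 + (n * 2 + p * 1)) + ((2 + (n * 2 + p * 1)) + (sumBy (row ∘ ⟨rᵏs⟩) (downFrom n) + p * (2 + n * 2)))
  sumBy-row = begin
    sumBy row codes                                        ≡⟨ sumBy-codes row ⟩
    row ⟨r⟩ + (row ⟨rᵖ⟩ + (Σ⟨rᵏs⟩ + Σ⟨rᵖ,rᶜs⟩))
      ≡⟨ cong₂ (λ x y → x + (y + (Σ⟨rᵏs⟩ + Σ⟨rᵖ,rᶜs⟩))) row-⟨r⟩ row-⟨rᵖ⟩ ⟩
    R + (R + (Σ⟨rᵏs⟩ + Σ⟨rᵖ,rᶜs⟩))
      ≡⟨ cong (λ z → R + (R + (Σ⟨rᵏs⟩ + z))) sumBy-row-⟨rᵖ,rᶜs⟩ ⟩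
    R + (R + (Σ⟨rᵏs⟩ + p * (2 + n * 2)))                   ∎
    where
    open ≡-Reasoning
    R = 2 + (n * 2 + p * 1)
    Σ⟨rᵏs⟩ = sumBy (row ∘ ⟨rᵏs⟩) (downFrom n)
    Σ⟨rᵖ,rᶜs⟩ = sumBy (row ∘ ⟨rᵖ,rᶜs⟩) (downFrom p)

  wiener-arithmetic : ∀ X → X + (2 + (n * 1 + p * 1)) ≡ sumBy row codes →
                      X ≡ 3 * p ^ 4 + 3 * p ^ 3 + 5 * p ^ 2 + 3 * p + 2
  wiener-arithmetic X X+|V|≡rows = +-cancelʳ-≡ (M + N) X _ (begin
    X + (M + N)                          ≡⟨ +-assoc X M N ⟨
    X + M + N                            ≡⟨ cong (_+ N) (trans X+|V|≡rows sumBy-row) ⟩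
    Rᵣ + (Rᵣ + (Σˢ + Σᵈ)) + N            ≡⟨ regroup Rᵣ Σˢ Σᵈ N ⟩
    Rᵣ + Rᵣ + Σᵈ + (Σˢ + N)              ≡⟨ cong (Rᵣ + Rᵣ + Σᵈ +_) sumBy-row-⟨rᵏs⟩ ⟩
    Rᵣ + Rᵣ + Σᵈ + n * (n * 3 + p * 2 + 4) ≡⟨ expand p ⟩
    3 * p ^ 4 + 3 * p ^ 3 + 5 * p ^ 2 + 3 * p + 2 + (M + N) ∎)
    where
    open ≡-Reasoning
    M = 2 + (n * 1 + p * 1)
    N = n * (p + 2)
    Rᵣ = 2 + (n * 2 + p * 1)
    Σˢ = sumBy (row ∘ ⟨rᵏs⟩) (downFrom n)
    Σᵈ = p * (2 + n * 2)
    regroup : ∀ a b c d → a + (a + (b + c)) + d ≡ a + a + c + (b + d)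
    regroup = solve-∀
    expand : ∀ p → let n = p * (p * 1) in
      2 + (n * 2 + p * 1) + (2 + (n * 2 + p * 1)) + p * (2 + n * 2) + n * (n * 3 + p * 2 + 4) ≡
      3 * (p * (p * (p * (p * 1)))) + 3 * (p * (p * (p * 1))) + 5 * (p * (p * 1)) + 3 * p + 2
        + (2 + (n * 1 + p * 1) + n * (p + 2))
    expand = solve-∀

  data RotationSubgroup (ρ : Fin n → Bool) : Set where
    all-rotations : (∀ i → ρ i ≡ residue 1 0 i) → RotationSubgroup ρ
    order-p       : (∀ i → ρ i ≡ residue p 0 i) → RotationSubgroup ρ
    trivial       : (∀ i → ρ i ≡ residue n 0 i) → RotationSubgroup ρ

  module _ (p-prime : Prime p) where

    module _ {ρ σ : Fin n → Bool} (laws : SubgroupLaws ρ σ) where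

      open SubgroupLaws laws using (ρ-identity)

      unit⇒all-rotations : ∀ {i} → ρ i ≡ true → ¬ p ∣ toℕ i → ∀ j → ρ j ≡ residue 1 0 j
      unit⇒all-rotations {i} ρi p∤i j = bool-ext
        (λ _ → ≡⇒≡ᵇ≡true (n%1≡0 (toℕ j)))
        (λ _ → divisor-closed laws (<-trans 1<p p<n) ρr¹ j (divides (toℕ j) (sym (*-identityʳ _))))
        where
        i⊥p : Coprime (toℕ i) p
        i⊥p = ∤⇒coprime p-prime p∤i
        ρr¹ : ρ (ofℕ 1) ≡ true
        ρr¹ = subst (λ g → ρ (ofℕ g) ≡ true)
                    (coprime⇒gcd≡1 (subst (Coprime (toℕ i)) (sym n≡p*p) (coprime-* i⊥p i⊥p)))
                    (gcd-closed laws i ρi)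

      gcd[ap,n]≡p : ∀ {a} → 0 < a → a < p → gcd (a * p) n ≡ p
      gcd[ap,n]≡p {a@(suc _)} _ a<p = begin
        gcd (a * p) n             ≡⟨ cong₂ gcd (*-comm a p) n≡p*p ⟩
        gcd (p * a) (p * p)       ≡⟨ c*gcd[m,n]≡gcd[cm,cn] p a p ⟨
        p * gcd a p               ≡⟨ cong (p *_) (coprime⇒gcd≡1 (Coprime.sym (prime⇒coprime p-prime a<p))) ⟩
        p * 1                     ≡⟨ *-identityʳ p ⟩
        p                         ∎
        where open ≡-Reasoning

      multiples-of-p : (∀ {j} → ρ j ≡ true → p ∣ toℕ j) → ∀ {i} → ρ i ≡ true → toℕ i ≢ 0 →
                       ∀ j → ρ j ≡ residue p 0 j
      multiples-of-p p∣ρ {i} ρi i≢0 j = bool-ext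
        (λ ρj → ≡⇒≡ᵇ≡true (n∣m⇒m%n≡0 (toℕ j) p (p∣ρ ρj)))
        (λ j∈ → divisor-closed laws p<n ρrᵖ j (m%n≡0⇒n∣m (toℕ j) p (≡ᵇ≡true⇒≡ j∈)))
        where
        ρrᵖ : ρ (ofℕ p) ≡ true
        ρrᵖ with p∣ρ ρi
        ... | divides a i≡ap = subst (λ g → ρ (ofℕ g) ≡ true)
                (trans (cong (λ x → gcd x n) i≡ap) (gcd[ap,n]≡p (0<a i≡ap) a<p)) (gcd-closed laws i ρi)
          where
          0<a : ∀ {b} → toℕ i ≡ b * p → 0 < b
          0<a {zero}  i≡0 = contradiction i≡0 i≢0
          0<a {suc _} _   = s≤s z≤n
          a<p : a < p
          a<p = *-cancelʳ-< p a p (subst (_< p * p) i≡ap (subst (toℕ i <_) n≡p*p (Fin.toℕ<n i)))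

      identity⇒trivial : (∀ {j} → ρ j ≡ true → toℕ j ≡ 0) → ∀ j → ρ j ≡ residue n 0 j
      identity⇒trivial j≡0 j = bool-ext
        (λ ρj → ≡⇒≡ᵇ≡true (trans (toℕ%N j) (j≡0 ρj)))
        (λ j∈ → trans (cong ρ (Fin.toℕ-injective {j = fzero} (trans (sym (toℕ%N j)) (≡ᵇ≡true⇒≡ j∈)))) ρ-identity)

      rotation-subgroup : RotationSubgroup ρ
      rotation-subgroup with Fin.any? (λ i → (ρ i Bool.≟ true) ×-dec ¬? (p ∣? toℕ i))
      ... | yes (i , ρi , p∤i) = all-rotations (unit⇒all-rotations ρi p∤i)
      ... | no no-unit with Fin.any? (λ i → (ρ i Bool.≟ true) ×-dec ¬? (toℕ i ≟ 0))
      ...   | yes (i , ρi , i≢0) = order-p (multiples-of-p p∣ρ ρi i≢0)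
        where
        p∣ρ : ∀ {j} → ρ j ≡ true → p ∣ toℕ j
        p∣ρ {j} ρj with p ∣? toℕ j
        ... | yes p∣j = p∣j
        ... | no  p∤j = contradiction (j , ρj , p∤j) no-unit
      ...   | no only-identity = trivial (identity⇒trivial j≡0)
        where
        j≡0 : ∀ {j} → ρ j ≡ true → toℕ j ≡ 0
        j≡0 {j} ρj with toℕ j ≟ 0
        ... | yes j≡0 = j≡0
        ... | no  j≢0 = contradiction (j , ρj , j≢0) only-identity

    module _ {R S : Vec Bool n} where

      all-rotations+reflection⇒improper : (∀ i → lookup R i ≡ residue 1 0 i) →
        SubgroupLaws (lookup R) (lookup S) → ∀ {j₀} → lookup S j₀ ≡ true → isProper (R , S) ≡ false
      all-rotations+reflection⇒improper R≗ laws {j₀} Sj₀ =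
        any-≡false⁺ (λ x → not (mem x (R , S))) (elems n) (λ x _ → cong not (everything x))
        where
        everything : ∀ x → mem x (R , S) ≡ true
        everything (i , false) = trans (R≗ i) (cong (_≡ᵇ 0) (n%1≡0 (toℕ i)))
        everything (i , true)  = trans (reflections-coset laws 1 1∣n R≗ Sj₀ i)
                                       (cong₂ _≡ᵇ_ (n%1≡0 (toℕ i)) (n%1≡0 (toℕ j₀)))

      identity-only⇒trivial : (∀ i → lookup R i ≡ residue n 0 i) → (∀ j → lookup S j ≡ false) →
                              isNontrivial (R , S) ≡ false
      identity-only⇒trivial R≗ S≗∅ = any-≡false⁺ (λ x → not (isId x) ∧ mem x (R , S)) (elems n) only-identity
        where
        only-identity : ∀ x → x ∈ elems n → (not (isId x) ∧ mem x (R , S)) ≡ false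
        only-identity (i , false) _ with lookup R i in Ri
        ... | true rewrite trans (sym (toℕ%N i)) (≡ᵇ≡true⇒≡ (trans (sym (R≗ i)) Ri)) = refl
        ... | false = Bool.∧-zeroʳ _
        only-identity (j , true) _ = S≗∅ j

    classify : ∀ H → isVertex H ≡ true → ∃[ c ] Valid c × H ≡ subgroup c
    classify (R , S) H-vertex =
      by-cases (Fin.any? (λ j → lookup S j Bool.≟ true)) (rotation-subgroup laws)
      where
      laws : SubgroupLaws (lookup R) (lookup S)
      laws = isSubgroup⁻ {R = R} {S = S} (proj₁ (∧-≡true⁻ H-vertex))
      nontrivial : isNontrivial (R , S) ≡ true
      nontrivial = proj₁ (∧-≡true⁻ (proj₂ (∧-≡true⁻ {isSubgroup (R , S)} H-vertex)))
      proper : isProper (R , S) ≡ true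
      proper = proj₂ (∧-≡true⁻ (proj₂ (∧-≡true⁻ {isSubgroup (R , S)} H-vertex)))
      absent : ¬ (∃ λ j → lookup S j ≡ true) → ∀ j → lookup S j ≡ false
      absent none j = Bool.¬-not (λ Sj → none (j , Sj))
      by-cases : Dec (∃ λ j → lookup S j ≡ true) → RotationSubgroup (lookup R) →
                 ∃[ c ] Valid c × (R , S) ≡ subgroup c
      by-cases (yes (j₀ , Sj₀)) (all-rotations R≗) =
        contradiction (trans (sym proper) (all-rotations+reflection⇒improper {R = R} {S = S} R≗ laws Sj₀)) λ ()
      by-cases (yes (j₀ , Sj₀)) (order-p R≗) = ⟨rᵖ,rᶜs⟩ (toℕ j₀ % p) , m%n<n (toℕ j₀) p ,
        cong₂ _,_ (tabulate-lookup-≗ R R≗) (tabulate-lookup-≗ S (reflections-coset laws p p∣n R≗ Sj₀))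
      by-cases (yes (j₀ , Sj₀)) (trivial R≗) = ⟨rᵏs⟩ (toℕ j₀ % n) , m%n<n (toℕ j₀) n ,
        cong₂ _,_ (tabulate-lookup-≗ R R≗) (tabulate-lookup-≗ S (reflections-coset laws n ∣-refl R≗ Sj₀))
      by-cases (no no-reflection) (all-rotations R≗) =
        ⟨r⟩ , tt , cong₂ _,_ (tabulate-lookup-≗ R R≗) (tabulate-lookup-≗ S (absent no-reflection))
      by-cases (no no-reflection) (order-p R≗) =
        ⟨rᵖ⟩ , tt , cong₂ _,_ (tabulate-lookup-≗ R R≗) (tabulate-lookup-≗ S (absent no-reflection))
      by-cases (no no-reflection) (trivial R≗) =
        contradiction (trans (sym nontrivial) (identity-only⇒trivial {R = R} {S = S} R≗ (absent no-reflection))) λ ()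

    isVertex-image : ∀ H → ind (isVertex H) ≡ sumBy (λ c → δ _≟ˢ_ (subgroup c) H) codes
    isVertex-image H with isVertex H in H-vertex
    ... | true with classify H H-vertex
    ...   | c₀ , v₀ , refl = sym (trans
              (sumBy-cong codes (λ c c∈ → δ-injective _≟ᶜ_ _≟ˢ_ (subgroup-injective (codes-valid c∈) v₀)))
              (codes-enumerate c₀ v₀))
    isVertex-image H | false = sym (sumBy-zero codes not-subgroup)
      where
      not-subgroup : ∀ c → c ∈ codes → δ _≟ˢ_ (subgroup c) H ≡ 0
      not-subgroup c c∈ = δ-≢ _≟ˢ_ {subgroup c} {H} λ { refl →
        contradiction (trans (sym (subgroup-isVertex c (codes-valid c∈))) H-vertex) λ () }

    sumBy-vertices : ∀ h → sumBy h V ≡ sumBy (h ∘ subgroup) codes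
    sumBy-vertices = sumBy-filterᵇ-image (_≟ˢ_ {n}) {xs = subsets n} (subsets-enumerates n) isVertex subgroup codes isVertex-image

    vertex-classify : ∀ {H} → H ∈ V → ∃[ c ] Valid c × H ≡ subgroup c
    vertex-classify {H} H∈V = classify H (T⇒≡true (proj₂ (∈-filter⁻ (T? ∘ isVertex) {xs = subsets n} H∈V)))

    common-via : ∀ a b c → Valid a → Valid b → Valid c → meetCode a c ≡ true → meetCode c b ≡ true →
                 commonNeighbour V meetNontrivially (subgroup a) (subgroup b) ≡ true
    common-via a b c va vb vc ac cb =
      any-≡true⁺ (λ z → meetNontrivially (subgroup a) z ∧ meetNontrivially z (subgroup b)) (subgroup∈V c vc)
                 (∧-≡true⁺ (trans (meet-subgroup a c va vc) ac) (trans (meet-subgroup c b vc vb) cb))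

    no-common : ∀ k k′ → k′ % p ≢ k % p → ∀ c → (meetCode (⟨rᵏs⟩ k) c ∧ meetCode c (⟨rᵏs⟩ k′)) ≡ false
    no-common k k′ k≢k′ ⟨r⟩ = refl
    no-common k k′ k≢k′ ⟨rᵖ⟩ = refl
    no-common k k′ k≢k′ (⟨rᵏs⟩ j) with j ≡ᵇ k in j≡k | k′ ≡ᵇ j in k′≡j
    ... | true  | true  = contradiction (cong (_% p) (trans (≡ᵇ≡true⇒≡ {k′} {j} k′≡j) (≡ᵇ≡true⇒≡ {j} {k} j≡k))) k≢k′
    ... | true  | false = refl
    ... | false | _     = refl
    no-common k k′ k≢k′ (⟨rᵖ,rᶜs⟩ c) with k % p ≡ᵇ c in k≡c | k′ % p ≡ᵇ c in k′≡c
    ... | true  | true  = contradiction (trans (≡ᵇ≡true⇒≡ {k′ % p} {c} k′≡c) (sym (≡ᵇ≡true⇒≡ {k % p} {c} k≡c))) k≢k′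
    ... | true  | false = refl
    ... | false | _     = refl

    commonNeighbour-subgroup : ∀ a b → Valid a → Valid b → meetCode a b ≡ false →
                          commonNeighbour V meetNontrivially (subgroup a) (subgroup b) ≡ cnCode a b
    commonNeighbour-subgroup (⟨rᵏs⟩ k) ⟨r⟩ va vb _ =
      common-via (⟨rᵏs⟩ k) ⟨r⟩ (⟨rᵖ,rᶜs⟩ (k % p)) va vb (hub<p (⟨rᵏs⟩ k)) (meetCode-hub (⟨rᵏs⟩ k)) refl
    commonNeighbour-subgroup (⟨rᵏs⟩ k) ⟨rᵖ⟩ va vb _ =
      common-via (⟨rᵏs⟩ k) ⟨rᵖ⟩ (⟨rᵖ,rᶜs⟩ (k % p)) va vb (hub<p (⟨rᵏs⟩ k)) (meetCode-hub (⟨rᵏs⟩ k)) refl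
    commonNeighbour-subgroup (⟨rᵏs⟩ k) (⟨rᵖ,rᶜs⟩ c) va vb _ =
      common-via (⟨rᵏs⟩ k) (⟨rᵖ,rᶜs⟩ c) (⟨rᵖ,rᶜs⟩ (k % p)) va vb (hub<p (⟨rᵏs⟩ k)) (meetCode-hub (⟨rᵏs⟩ k)) refl
    commonNeighbour-subgroup ⟨r⟩ (⟨rᵏs⟩ k) va vb _ =
      common-via ⟨r⟩ (⟨rᵏs⟩ k) (⟨rᵖ,rᶜs⟩ (k % p)) va vb (hub<p (⟨rᵏs⟩ k)) refl (meetCode-hub (⟨rᵏs⟩ k))
    commonNeighbour-subgroup ⟨rᵖ⟩ (⟨rᵏs⟩ k) va vb _ =
      common-via ⟨rᵖ⟩ (⟨rᵏs⟩ k) (⟨rᵖ,rᶜs⟩ (k % p)) va vb (hub<p (⟨rᵏs⟩ k)) refl (meetCode-hub (⟨rᵏs⟩ k))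
    commonNeighbour-subgroup (⟨rᵖ,rᶜs⟩ c) (⟨rᵏs⟩ k) va vb _ =
      common-via (⟨rᵖ,rᶜs⟩ c) (⟨rᵏs⟩ k) (⟨rᵖ,rᶜs⟩ (k % p)) va vb (hub<p (⟨rᵏs⟩ k)) refl (meetCode-hub (⟨rᵏs⟩ k))
    commonNeighbour-subgroup (⟨rᵏs⟩ k) (⟨rᵏs⟩ k′) va vb _ with k′ % p ≡ᵇ k % p in same-residue
    ... | true  = common-via (⟨rᵏs⟩ k) (⟨rᵏs⟩ k′) (⟨rᵖ,rᶜs⟩ (k % p)) va vb
                             (hub<p (⟨rᵏs⟩ k)) (meetCode-hub (⟨rᵏs⟩ k)) same-residue
    ... | false = any-≡false⁺ _ V none
      where
      none : ∀ z → z ∈ V → (meetNontrivially (subgroup (⟨rᵏs⟩ k)) z ∧ meetNontrivially z (subgroup (⟨rᵏs⟩ k′))) ≡ false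
      none z z∈V with vertex-classify z∈V
      ... | c , vc , refl rewrite meet-subgroup (⟨rᵏs⟩ k) c va vc | meet-subgroup c (⟨rᵏs⟩ k′) vc vb = no-common k k′ (≡ᵇ≡false⇒≢ same-residue) c
    commonNeighbour-subgroup ⟨r⟩ ⟨r⟩ _ _ ()
    commonNeighbour-subgroup ⟨r⟩ ⟨rᵖ⟩ _ _ ()
    commonNeighbour-subgroup ⟨r⟩ (⟨rᵖ,rᶜs⟩ _) _ _ ()
    commonNeighbour-subgroup ⟨rᵖ⟩ ⟨r⟩ _ _ ()
    commonNeighbour-subgroup ⟨rᵖ⟩ ⟨rᵖ⟩ _ _ ()
    commonNeighbour-subgroup ⟨rᵖ⟩ (⟨rᵖ,rᶜs⟩ _) _ _ ()
    commonNeighbour-subgroup (⟨rᵖ,rᶜs⟩ _) ⟨r⟩ _ _ ()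
    commonNeighbour-subgroup (⟨rᵖ,rᶜs⟩ _) ⟨rᵖ⟩ _ _ ()
    commonNeighbour-subgroup (⟨rᵖ,rᶜs⟩ _) (⟨rᵖ,rᶜs⟩ _) _ _ ()

    dist≤3-subgroup : ∀ a b → Valid a → Valid b → dist≤3 V meetNontrivially (subgroup a) (subgroup b) ≡ distCode a b
    dist≤3-subgroup a b va vb rewrite meet-subgroup a b va vb with meetCode a b in ab
    ... | true  = refl
    ... | false rewrite commonNeighbour-subgroup a b va vb ab = refl

    Hub : Sub n → Set
    Hub H = ∃[ c ] c < p × H ≡ subgroup (⟨rᵖ,rᶜs⟩ c)

    hub-of : ∀ H → H ∈ V → ∃[ h ] h ∈ V × Hub h × meetNontrivially H h ≡ true
    hub-of H H∈V with vertex-classify H∈V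
    ... | a , va , refl = subgroup (⟨rᵖ,rᶜs⟩ (hub a)) , subgroup∈V (⟨rᵖ,rᶜs⟩ (hub a)) (hub<p a) ,
                          (hub a , hub<p a , refl) ,
                          trans (meet-subgroup a (⟨rᵖ,rᶜs⟩ (hub a)) va (hub<p a)) (meetCode-hub a)

    hubs-meet : ∀ {h h′} → Hub h → Hub h′ → meetNontrivially h h′ ≡ true
    hubs-meet (c , c<p , refl) (c′ , c′<p , refl) = meet-subgroup (⟨rᵖ,rᶜs⟩ c) (⟨rᵖ,rᶜs⟩ c′) c<p c′<p

    self-meet : ∀ H → H ∈ V → meetNontrivially H H ≡ true
    self-meet H H∈V with vertex-classify H∈V
    ... | a , va , refl = trans (meet-subgroup a a va va) (meetCode-refl a)
      where
      meetCode-refl : ∀ a → meetCode a a ≡ true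
      meetCode-refl ⟨r⟩          = refl
      meetCode-refl ⟨rᵖ⟩         = refl
      meetCode-refl (⟨rᵏs⟩ k)    = ≡ᵇ-refl k
      meetCode-refl (⟨rᵖ,rᶜs⟩ _) = refl

    vertex-count : length V ≡ 1 + (1 + (n * 1 + p * 1))
    vertex-count = begin
      length V                    ≡⟨ *-identityʳ (length V) ⟨
      length V * 1                ≡⟨ sumBy-const 1 V ⟨
      sumBy (λ _ → 1) V           ≡⟨ sumBy-vertices (λ _ → 1) ⟩
      sumBy (λ _ → 1) codes       ≡⟨ sumBy-codes (λ _ → 1) ⟩
      1 + (1 + (sumBy (λ _ → 1) (downFrom n) + sumBy (λ _ → 1) (downFrom p)))
                                  ≡⟨ cong₂ (λ x y → 1 + (1 + (x + y))) (sumBy-const-downFrom 1 n) (sumBy-const-downFrom 1 p) ⟩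
      1 + (1 + (n * 1 + p * 1))   ∎
      where open ≡-Reasoning

    distance-sum : sumBy (λ x → sumBy (dist≤3 V meetNontrivially x) V) V ≡ sumBy row codes
    distance-sum = begin
      sumBy (λ x → sumBy (dist≤3 V meetNontrivially x) V) V
        ≡⟨ sumBy-vertices (λ x → sumBy (dist≤3 V meetNontrivially x) V) ⟩
      sumBy (λ a → sumBy (dist≤3 V meetNontrivially (subgroup a)) V) codes
        ≡⟨ sumBy-cong codes (λ a _ → sumBy-vertices (dist≤3 V meetNontrivially (subgroup a))) ⟩
      sumBy (λ a → sumBy (dist≤3 V meetNontrivially (subgroup a) ∘ subgroup) codes) codes
        ≡⟨ sumBy-cong codes (λ a a∈ → sumBy-cong codes (λ b b∈ → dist≤3-subgroup a b (codes-valid a∈) (codes-valid b∈))) ⟩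
      sumBy row codes ∎
      where open ≡-Reasoning

    wiener : Σ ℕ λ W → HasWienerIndex (IntersectionGraphD n) W × 2 * W ≡ 3 * p ^ 4 + 3 * p ^ 3 + 5 * p ^ 2 + 3 * p + 2
    wiener = W , (distance V meetNontrivially , distance-isDistance V meetNontrivially meetNontrivially-sym Hub hub-of hubs-meet , refl) ,
             wiener-arithmetic (2 * W) (begin
               2 * W + (2 + (n * 1 + p * 1))                        ≡⟨ cong (2 * W +_) vertex-count ⟨
               2 * W + length V                                     ≡⟨ wiener-double V meetNontrivially meetNontrivially-sym self-meet ⟩
               sumBy (λ x → sumBy (dist≤3 V meetNontrivially x) V) V ≡⟨ distance-sum ⟩
               sumBy row codes                                      ∎)
      where
      open ≡-Reasoning
      W = sumPairs (length V) (distance V meetNontrivially)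

theorem3p1 : (p : ℕ) → Prime p →
    Σ ℕ λ W → HasWienerIndex (IntersectionGraphD (p ^ 2)) W
    × 2 * W ≡ 3 * p ^ 4 + 3 * p ^ 3 + 5 * p ^ 2 + 3 * p + 2
theorem3p1 0             p-prime = ⊥-elim (¬prime[0] p-prime)
theorem3p1 1             p-prime = ⊥-elim (¬prime[1] p-prime)
theorem3p1 (suc (suc q)) p-prime = Dihedral.wiener q p-prime
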